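{- Let $\gamma,\delta$ be complex numbers such that $\gamma\delta$ and $(\gamma+\delta)^2$ are nonzero coprime integers and $\gamma/\delta$ is not a root of unity. Write $(\gamma^2-\delta^2)^2 = D_0 D_1^2$ with $D_0, D_1 \in \mathbb{Z}$ and $D_0$ squarefree, and suppose $D_0 \ge 5$ and $D_0 \equiv 1 \pmod 4$. Then for every positive integer $\ell$ with $4D_0 \mid \ell$, every odd primitive divisor $p$ of $u_\ell(\gamma,\delta)$ satisfies $p \equiv 1 \pmod 4$.
   Context: The Lehmer sequence is $u_k(\gamma,\delta) := (\gamma^k-\delta^k)/(\gamma-\delta)$ for odd $k$ and $u_k(\gamma,\delta) := (\gamma^k-\delta^k)/(\gamma^2-\delta^2)$ for even $k$; these are integers, and $(\gamma^2-\delta^2)^2$ is an integer. A prime $p$ is a primitive divisor of $u_k(\gamma,\delta)$ if $p \mid u_k(\gamma,\delta)$ but $p \nmid (\gamma^2-\delta^2)^2 u_1(\gamma,\delta)\cdots u_{k-1}(\gamma,\delta)$. -}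

module Defs where

open import Data.Bool using (Bool; true; false; if_then_else_)
open import Data.Nat using (ℕ; zero; suc)
open import Data.Integer using (ℤ; +_; _+_; _-_; _*_; 0ℤ; 1ℤ)
open import Data.Integer.Divisibility using (_∣_)
open import Data.Nat.Primality using (Prime)
open import Relation.Nullary using (¬_)

isEven : ℕ → Bool
isEven zero = true
isEven (suc n) with isEven n
... | true = false
... | false = true

-- Lehmer sequence u_k(γ,δ) expressed through the integers
-- R = (γ+δ)^2 and Q = γδ (the Lehmer recurrence):
-- u_0 = 0, u_1 = 1,
-- u_{n+2} = u_{n+1} - Q u_n      (n even)
-- u_{n+2} = R u_{n+1} - Q u_n    (n odd)
lehmer : ℤ → ℤ → ℕ → ℤ
lehmer R Q zero = 0ℤ
lehmer R Q (suc zero) = 1ℤ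
lehmer R Q (suc (suc n)) =
  (if isEven n then lehmer R Q (suc n) else R * lehmer R Q (suc n)) - Q * lehmer R Q n

-- (γ^2 - δ^2)^2 = (γ+δ)^2 ((γ+δ)^2 - 4γδ) = R (R - 4Q)
lehmerDisc : ℤ → ℤ → ℤ
lehmerDisc R Q = R * (R - + 4 * Q)

lehmerProdBelow : ℤ → ℤ → ℕ → ℤ
lehmerProdBelow R Q zero = 1ℤ
lehmerProdBelow R Q (suc zero) = 1ℤ
lehmerProdBelow R Q (suc (suc k)) = lehmerProdBelow R Q (suc k) * lehmer R Q (suc k)

PrimitiveDivisor : ℤ → ℤ → ℕ → ℕ → Set
PrimitiveDivisor R Q k p =
  Prime p × (+ p ∣ lehmer R Q k) × ¬ (+ p ∣ (lehmerDisc R Q * lehmerProdBelow R Q k))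
  where open import Data.Product using (_×_)

SquareFree : ℤ → Set
SquareFree n = ∀ (d : ℤ) → (d * d) ∣ n → d ∣ 1ℤ

module Submission where

-- Write P = R - 2Q = γ² + δ² and W = Q² = (γδ)².  Then u_2k is the Lucas sequence U_k(P, W) of
-- α = γ², β = δ², with discriminant Δ = P² - 4W = (γ² - δ²)², and we compute in the ring
-- A = (ℤ/p)[α]/(α² - Pα + W).  If p is a primitive divisor of u_ℓ, ℓ = 2m, then p ∤ Δ and m is the
-- rank of apparition of p: α^n lies in ℤ/p exactly when m ∣ n.  By Euler's criterion the Frobenius
-- x ↦ x^p fixes α if Δ is a square mod p and swaps α and β otherwise, so m ∣ (p - 1)/2 or m ∣ (p + 1)/2.
-- As 2 D₀ ∣ m, the first case gives p ≡ 1 (mod 4).  In the second case A is a field and θ = α/Q has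
-- order 2m, so A contains a square root i of -1 and, for every prime q ∣ D₀, a primitive q-th root of
-- unity η.  The Gauss product Z = ∏ i (ρʲ - ρ⁻ʲ), ρ² = η, satisfies Z² = q and Z^p = Z, so every such q,
-- hence D₀ and Δ = D₀ D₁², is a square mod p: a contradiction.

open import Data.Nat.Base using (ℕ)
open import Data.Integer.Base using (ℤ)
open import Data.Nat.Primality using (Prime)
open import Algebra.Bundles using (CommutativeRing)
import Data.Nat.Base as ℕ
open import Relation.Binary.PropositionalEquality using (_≡_)
open import Defs

module Congruence where

  open import Data.Nat.Base using (ℕ; zero; suc)
  open import Data.Integer.Base using (ℤ; +_; _+_; _-_; _*_; -_; _^_; 0ℤ)
  open import Data.Integer.Divisibility.Signed
    using (_∣_; divides; ∣m∣n⇒∣m+n; ∣m⇒∣-m; ∣n⇒∣m*n; ∣m⇒∣m*n)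
  open import Data.List.Base using (_∷_; [])
  open import Relation.Binary.PropositionalEquality using (_≡_; subst)
  open import Data.Integer.Tactic.RingSolver using (solve)

  infix 4 _≡_mod_
  record _≡_mod_ (a b : ℤ) (n : ℕ) : Set where
    constructor mk≡mod
    field ∣-diff : + n ∣ a - b
  open _≡_mod_ public

  module _ {n : ℕ} where

    private
      _by_ : ∀ {a b} → + n ∣ a → a ≡ b → + n ∣ b
      d by eq = subst (+ n ∣_) eq d

    refl : ∀ {a} → a ≡ a mod n
    refl {a} = mk≡mod ((divides 0ℤ _≡_.refl) by solve (a ∷ []))

    reflexive : ∀ {a b} → a ≡ b → a ≡ b mod n
    reflexive _≡_.refl = refl

    sym : ∀ {a b} → a ≡ b mod n → b ≡ a mod n
    sym {a} {b} (mk≡mod d) = mk≡mod ((∣m⇒∣-m d) by solve (a ∷ b ∷ []))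

    trans : ∀ {a b c} → a ≡ b mod n → b ≡ c mod n → a ≡ c mod n
    trans {a} {b} {c} (mk≡mod d) (mk≡mod e) = mk≡mod ((∣m∣n⇒∣m+n d e) by solve (a ∷ b ∷ c ∷ []))

    +-cong : ∀ {a b c d} → a ≡ b mod n → c ≡ d mod n → a + c ≡ b + d mod n
    +-cong {a} {b} {c} {d} (mk≡mod x) (mk≡mod y) =
      mk≡mod ((∣m∣n⇒∣m+n x y) by solve (a ∷ b ∷ c ∷ d ∷ []))

    -‿cong : ∀ {a b} → a ≡ b mod n → - a ≡ - b mod n
    -‿cong {a} {b} (mk≡mod x) = mk≡mod ((∣m⇒∣-m x) by solve (a ∷ b ∷ []))

    *-cong : ∀ {a b c d} → a ≡ b mod n → c ≡ d mod n → a * c ≡ b * d mod n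
    *-cong {a} {b} {c} {d} (mk≡mod x) (mk≡mod y) =
      mk≡mod ((∣m∣n⇒∣m+n (∣m⇒∣m*n c x) (∣n⇒∣m*n b y)) by solve (a ∷ b ∷ c ∷ d ∷ []))

    -cong : ∀ {a b c d} → a ≡ b mod n → c ≡ d mod n → a - c ≡ b - d mod n
    -cong x y = +-cong x (-‿cong y)

    ^-cong : ∀ {a b} k → a ≡ b mod n → a ^ k ≡ b ^ k mod n
    ^-cong zero    _ = refl
    ^-cong (suc k) x = *-cong x (^-cong k x)

    ∣⇒≡0 : ∀ {a} → + n ∣ a → a ≡ 0ℤ mod n
    ∣⇒≡0 {a} d = mk≡mod (d by solve (a ∷ []))

    ≡0⇒∣ : ∀ {a} → a ≡ 0ℤ mod n → + n ∣ a
    ≡0⇒∣ {a} (mk≡mod d) = d by solve (a ∷ [])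

module Mod = Congruence

module OddNumbers where

  open import Data.Nat.Base using (zero; suc; _+_; _*_; _<_; _≤_; s≤s; z≤n)
  open import Data.Nat.Properties using (≤-trans; ≤-reflexive; +-suc; +-comm)
  open import Data.Nat.DivMod using (_%_; _/_; m≡m%n+[m/n]*n; m%n<n; [m+kn]%n≡m%n)
  open import Data.Nat.Divisibility using (_∣_; divides; m%n≡0⇒n∣m; ∣m+n∣m⇒∣n; ∣-trans; ∣1⇒≡1)
  open import Data.Empty using (⊥-elim)
  open import Function.Base using (_∘_)
  open import Relation.Nullary using (¬_)
  open import Relation.Binary.PropositionalEquality using (_≡_; refl; cong; sym; trans; subst)
  open import Data.Nat.Tactic.RingSolver using (solve-∀)

  odd>1⇒≥3 : ∀ k → 1 < suc (k + k) → 3 ≤ suc (k + k)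
  odd>1⇒≥3 zero    (s≤s ())
  odd>1⇒≥3 (suc k) _ = s≤s (s≤s (≤-trans (s≤s z≤n) (≤-reflexive (sym (+-suc k k)))))

  2∤n⇒n%2≡1 : ∀ n → ¬ 2 ∣ n → n % 2 ≡ 1
  2∤n⇒n%2≡1 n 2∤n = remainder (n % 2) (m%n<n n 2) (2∤n ∘ m%n≡0⇒n∣m n 2)
    where
    remainder : ∀ r → r < 2 → ¬ r ≡ 0 → r ≡ 1
    remainder zero          _               r≢0 = ⊥-elim (r≢0 refl)
    remainder (suc zero)    _               _   = refl
    remainder (suc (suc r)) (s≤s (s≤s ())) _

  2∣h⇒[2h+1]%4≡1 : ∀ h → 2 ∣ h → suc (h + h) % 4 ≡ 1
  2∣h⇒[2h+1]%4≡1 h (divides k h≡k*2) = trans (cong (λ h → suc (h + h) % 4) h≡k*2)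
                                              (trans (cong (_% 4) (shape k)) ([m+kn]%n≡m%n 1 k 4))
    where
    shape : ∀ k → suc (k * 2 + k * 2) ≡ 1 + k * 4
    shape = solve-∀

  4∣n⇒2∤1+n : ∀ n → 4 ∣ n → ¬ 2 ∣ suc n
  4∣n⇒2∤1+n n 4∣n 2∣1+n = 2∤1 (∣m+n∣m⇒∣n (subst (2 ∣_) (+-comm 1 n) 2∣1+n) (∣-trans (divides 2 refl) 4∣n))
    where
    2∤1 : ¬ 2 ∣ 1
    2∤1 2∣1 with ∣1⇒≡1 2∣1
    ... | ()

  odd⇒≡2k+1 : ∀ n → n % 2 ≡ 1 → n ≡ suc (n / 2 + n / 2)
  odd⇒≡2k+1 n n%2≡1 = trans (m≡m%n+[m/n]*n n 2) (trans (cong (_+ (n / 2) * 2) n%2≡1) (cong suc (*2≡+ (n / 2))))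
    where
    *2≡+ : ∀ k → k * 2 ≡ k + k
    *2≡+ = solve-∀

module PrimeDivisibility {p : ℕ} (p-prime : Prime p) where

  open import Data.Nat.Base using (ℕ; zero; suc)
  open import Data.Integer.Base as ℤ using (ℤ; +_; _-_; -_; _*_; _^_; 1ℤ)
  open import Data.Integer.Properties using (abs-*)
  open import Data.Integer.Tactic.RingSolver using (solve-∀)
  open Congruence using (_≡_mod_; mk≡mod)
  open import Data.Integer.Divisibility.Signed using (_∣_; ∣⇒∣ᵤ; ∣ᵤ⇒∣)
  import Data.Nat.Divisibility as ℕ
  open import Data.Nat.Primality using (Prime; euclidsLemma; prime⇒nonTrivial)
  open import Data.Nat.Base using (nonTrivial⇒≢1)
  open import Data.Sum as Sum using (_⊎_; inj₁; inj₂; [_,_]′)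
  open import Data.Empty using (⊥-elim)
  open import Function.Base using (id; _∘_)
  open import Relation.Nullary using (¬_)
  open import Relation.Binary.PropositionalEquality using (_≡_; refl; subst)

  ∣*⇒∣⊎∣ : ∀ a b → + p ∣ a * b → + p ∣ a ⊎ + p ∣ b
  ∣*⇒∣⊎∣ a b d with euclidsLemma ℤ.∣ a ∣ ℤ.∣ b ∣ p-prime (subst (p ℕ.∣_) (abs-* a b) (∣⇒∣ᵤ d))
  ... | inj₁ p∣a = inj₁ (∣ᵤ⇒∣ p∣a)
  ... | inj₂ p∣b = inj₂ (∣ᵤ⇒∣ p∣b)

  ∣m*n∧∤m⇒∣n : ∀ a b → + p ∣ a * b → ¬ + p ∣ a → + p ∣ b
  ∣m*n∧∤m⇒∣n a b p∣ab p∤a = [ ⊥-elim ∘ p∤a , id ]′ (∣*⇒∣⊎∣ a b p∣ab)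

  ∤1 : ¬ + p ∣ 1ℤ
  ∤1 d with ℕ.∣1⇒≡1 (∣⇒∣ᵤ d)
  ... | refl = nonTrivial⇒≢1 {{prime⇒nonTrivial p-prime}} refl

  ∤*∤⇒∤ : ∀ a b → ¬ + p ∣ a → ¬ + p ∣ b → ¬ + p ∣ a * b
  ∤*∤⇒∤ a b ∤a ∤b d = [ ∤a , ∤b ]′ (∣*⇒∣⊎∣ a b d)

  ∣^⇒∣ : ∀ a n → + p ∣ a ^ n → + p ∣ a
  ∣^⇒∣ a zero    d = ⊥-elim (∤1 d)
  ∣^⇒∣ a (suc n) d = [ id , ∣^⇒∣ a n ]′ (∣*⇒∣⊎∣ a (a ^ n) d)

  ∤⇒∤^ : ∀ a n → ¬ + p ∣ a → ¬ + p ∣ a ^ n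
  ∤⇒∤^ a n ∤a = ∤a ∘ ∣^⇒∣ a n

  x*x≡1⇒x≡±1 : ∀ x → x * x ≡ 1ℤ mod p → x ≡ 1ℤ mod p ⊎ x ≡ - 1ℤ mod p
  x*x≡1⇒x≡±1 x (mk≡mod d) =
    Sum.map mk≡mod mk≡mod (∣*⇒∣⊎∣ (x - 1ℤ) (x - - 1ℤ) (subst (+ p ∣_) (difference-of-squares x) d))
    where
    difference-of-squares : ∀ x → x * x - 1ℤ ≡ (x - 1ℤ) * (x - - 1ℤ)
    difference-of-squares = solve-∀

module QuadraticAlgebra (n : ℕ) (P W : ℤ) where

  open import Data.Integer.Base as ℤ using (ℤ; +_; 0ℤ; 1ℤ)
  import Data.Integer.Properties as ℤ
  open import Data.Product using (_×_; _,_; proj₁; proj₂)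
  open import Relation.Binary.PropositionalEquality as ≡ using (_≡_)
  open import Algebra.Bundles using (CommutativeRing)
  open import Algebra.Structures using (IsCommutativeRing)
  open import Relation.Binary.Bundles using (Setoid)
  open import Algebra.Consequences.Setoid using (comm∧idˡ⇒id; comm∧invˡ⇒inv; comm∧distrˡ⇒distr)
  open import Data.Integer.Tactic.RingSolver using (solve-∀)
  open import Level using (0ℓ)
  open Congruence using (_≡_mod_)

  -- (a , b) stands for a + b α, where α² = P α - W.
  Elt : Set
  Elt = ℤ × ℤ

  infix 4 _≈_
  record _≈_ (x y : Elt) : Set where
    constructor _&_
    field
      proj₁≈ : proj₁ x ≡ proj₁ y mod n
      proj₂≈ : proj₂ x ≡ proj₂ y mod n
  open _≈_ public

  ≡⇒≈ : ∀ {a b c d} → a ≡ c → b ≡ d → (a , b) ≈ (c , d)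
  ≡⇒≈ e f = Mod.reflexive e & Mod.reflexive f

  infixl 6 _⊕_
  infixl 7 _⊗_
  opaque
    _⊕_ : Elt → Elt → Elt
    (a , b) ⊕ (c , d) = (a ℤ.+ c , b ℤ.+ d)

    ⊝_ : Elt → Elt
    ⊝ (a , b) = (ℤ.- a , ℤ.- b)

    _⊗_ : Elt → Elt → Elt
    (a , b) ⊗ (c , d) = (a ℤ.* c ℤ.- W ℤ.* (b ℤ.* d) , a ℤ.* d ℤ.+ b ℤ.* c ℤ.+ P ℤ.* (b ℤ.* d))

  ι : ℤ → Elt
  ι c = (c , 0ℤ)

  α β : Elt
  α = (0ℤ , 1ℤ)
  β = (P , ℤ.- 1ℤ)

  conj : Elt → Elt
  conj (a , b) = (a ℤ.+ P ℤ.* b , ℤ.- b)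

  norm : Elt → ℤ
  norm (a , b) = a ℤ.* a ℤ.+ P ℤ.* a ℤ.* b ℤ.+ W ℤ.* b ℤ.* b

  Δ : ℤ
  Δ = P ℤ.* P ℤ.- + 4 ℤ.* W

  -- 2α - P, a square root of the discriminant
  √Δ : Elt
  √Δ = (ℤ.- P , + 2)

  ≈-refl : ∀ {x} → x ≈ x
  ≈-refl = Mod.refl & Mod.refl

  ≈-sym : ∀ {x y} → x ≈ y → y ≈ x
  ≈-sym (e & f) = Mod.sym e & Mod.sym f

  ≈-trans : ∀ {x y z} → x ≈ y → y ≈ z → x ≈ z
  ≈-trans (e & f) (g & h) = Mod.trans e g & Mod.trans f h

  private
    *-comm₁ : ∀ W a b c d → a ℤ.* c ℤ.- W ℤ.* (b ℤ.* d) ≡ c ℤ.* a ℤ.- W ℤ.* (d ℤ.* b)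
    *-comm₁ = solve-∀
    *-comm₂ : ∀ P a b c d → a ℤ.* d ℤ.+ b ℤ.* c ℤ.+ P ℤ.* (b ℤ.* d) ≡ c ℤ.* b ℤ.+ d ℤ.* a ℤ.+ P ℤ.* (d ℤ.* b)
    *-comm₂ = solve-∀
    *-assoc₁ : ∀ P W a b c d e f →
      (a ℤ.* c ℤ.- W ℤ.* (b ℤ.* d)) ℤ.* e ℤ.- W ℤ.* ((a ℤ.* d ℤ.+ b ℤ.* c ℤ.+ P ℤ.* (b ℤ.* d)) ℤ.* f)
      ≡ a ℤ.* (c ℤ.* e ℤ.- W ℤ.* (d ℤ.* f)) ℤ.- W ℤ.* (b ℤ.* (c ℤ.* f ℤ.+ d ℤ.* e ℤ.+ P ℤ.* (d ℤ.* f)))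
    *-assoc₁ = solve-∀
    *-assoc₂ : ∀ P W a b c d e f →
      (a ℤ.* c ℤ.- W ℤ.* (b ℤ.* d)) ℤ.* f ℤ.+ (a ℤ.* d ℤ.+ b ℤ.* c ℤ.+ P ℤ.* (b ℤ.* d)) ℤ.* e
        ℤ.+ P ℤ.* ((a ℤ.* d ℤ.+ b ℤ.* c ℤ.+ P ℤ.* (b ℤ.* d)) ℤ.* f)
      ≡ a ℤ.* (c ℤ.* f ℤ.+ d ℤ.* e ℤ.+ P ℤ.* (d ℤ.* f)) ℤ.+ b ℤ.* (c ℤ.* e ℤ.- W ℤ.* (d ℤ.* f))
        ℤ.+ P ℤ.* (b ℤ.* (c ℤ.* f ℤ.+ d ℤ.* e ℤ.+ P ℤ.* (d ℤ.* f)))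
    *-assoc₂ = solve-∀
    *-identityˡ₁ : ∀ W a b → 1ℤ ℤ.* a ℤ.- W ℤ.* (0ℤ ℤ.* b) ≡ a
    *-identityˡ₁ = solve-∀
    *-identityˡ₂ : ∀ P a b → 1ℤ ℤ.* b ℤ.+ 0ℤ ℤ.* a ℤ.+ P ℤ.* (0ℤ ℤ.* b) ≡ b
    *-identityˡ₂ = solve-∀
    distribˡ₁ : ∀ W a b c d e f → a ℤ.* (c ℤ.+ e) ℤ.- W ℤ.* (b ℤ.* (d ℤ.+ f))
                                  ≡ (a ℤ.* c ℤ.- W ℤ.* (b ℤ.* d)) ℤ.+ (a ℤ.* e ℤ.- W ℤ.* (b ℤ.* f))
    distribˡ₁ = solve-∀
    distribˡ₂ : ∀ P a b c d e f → a ℤ.* (d ℤ.+ f) ℤ.+ b ℤ.* (c ℤ.+ e) ℤ.+ P ℤ.* (b ℤ.* (d ℤ.+ f))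
                                  ≡ (a ℤ.* d ℤ.+ b ℤ.* c ℤ.+ P ℤ.* (b ℤ.* d)) ℤ.+ (a ℤ.* f ℤ.+ b ℤ.* e ℤ.+ P ℤ.* (b ℤ.* f))
    distribˡ₂ = solve-∀

    ≈-setoid : Setoid 0ℓ 0ℓ
    ≈-setoid = record
      { Carrier       = Elt
      ; _≈_           = _≈_
      ; isEquivalence = record { refl = ≈-refl ; sym = ≈-sym ; trans = ≈-trans }
      }

  opaque
    unfolding _⊕_ ⊝_ _⊗_

    private
      ⊕-cong : ∀ {x y u v} → x ≈ y → u ≈ v → x ⊕ u ≈ y ⊕ v
      ⊕-cong (e & f) (g & h) = Mod.+-cong e g & Mod.+-cong f h

      ⊕-comm : ∀ x y → x ⊕ y ≈ y ⊕ x
      ⊕-comm (a , b) (c , d) = ≡⇒≈ (ℤ.+-comm a c) (ℤ.+-comm b d)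

      ⊗-cong : ∀ {x y u v} → x ≈ y → u ≈ v → x ⊗ u ≈ y ⊗ v
      ⊗-cong (e & f) (g & h) =
        Mod.-cong (Mod.*-cong e g) (Mod.*-cong (Mod.refl {a = W}) (Mod.*-cong f h))
        & Mod.+-cong (Mod.+-cong (Mod.*-cong e h) (Mod.*-cong f g)) (Mod.*-cong (Mod.refl {a = P}) (Mod.*-cong f h))

      ⊗-comm : ∀ x y → x ⊗ y ≈ y ⊗ x
      ⊗-comm (a , b) (c , d) = ≡⇒≈ (*-comm₁ W a b c d) (*-comm₂ P a b c d)

    isCommutativeRing : IsCommutativeRing _≈_ _⊕_ _⊗_ ⊝_ (ι 0ℤ) (ι 1ℤ)
    isCommutativeRing = record
      { isRing = record
        { +-isAbelianGroup = record
          { isGroup = record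
            { isMonoid = record
              { isSemigroup = record
                { isMagma = record { isEquivalence = Setoid.isEquivalence ≈-setoid ; ∙-cong = ⊕-cong }
                ; assoc   = λ (a , b) (c , d) (e , f) → ≡⇒≈ (ℤ.+-assoc a c e) (ℤ.+-assoc b d f) }
              ; identity = comm∧idˡ⇒id ≈-setoid ⊕-comm λ (a , b) → ≡⇒≈ (ℤ.+-identityˡ a) (ℤ.+-identityˡ b) }
            ; inverse = comm∧invˡ⇒inv ≈-setoid ⊕-comm λ (a , b) → ≡⇒≈ (ℤ.+-inverseˡ a) (ℤ.+-inverseˡ b)
            ; ⁻¹-cong = λ (e & f) → Mod.-‿cong e & Mod.-‿cong f }
          ; comm = ⊕-comm }
        ; *-cong     = ⊗-cong
        ; *-assoc    = λ (a , b) (c , d) (e , f) → ≡⇒≈ (*-assoc₁ P W a b c d e f) (*-assoc₂ P W a b c d e f)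
        ; *-identity = comm∧idˡ⇒id ≈-setoid ⊗-comm λ (a , b) → ≡⇒≈ (*-identityˡ₁ W a b) (*-identityˡ₂ P a b)
        ; distrib    = comm∧distrˡ⇒distr ≈-setoid ⊕-cong ⊗-comm
                         λ (a , b) (c , d) (e , f) → ≡⇒≈ (distribˡ₁ W a b c d e f) (distribˡ₂ P a b c d e f) }
      ; *-comm = ⊗-comm }

  A : CommutativeRing 0ℓ 0ℓ
  A = record { isCommutativeRing = isCommutativeRing }

module IntegerPowers where

  open import Data.Nat.Base using (zero; suc)
  open import Data.Integer.Base using (_*_; _^_)
  open import Relation.Binary.PropositionalEquality using (_≡_; refl; cong; trans)
  open import Data.Integer.Tactic.RingSolver using (solve-∀)

  ^-distribʳ-* : ∀ a b n → (a * b) ^ n ≡ a ^ n * b ^ n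
  ^-distribʳ-* a b zero    = refl
  ^-distribʳ-* a b (suc n) = trans (cong ((a * b) *_) (^-distribʳ-* a b n)) (interchange a b (a ^ n) (b ^ n))
    where
    interchange : ∀ a b c d → (a * b) * (c * d) ≡ (a * c) * (b * d)
    interchange = solve-∀

module Lucas where

  open import Data.Nat.Base using (ℕ; zero; suc)
  open import Data.Integer.Base using (ℤ; _-_; _*_; 0ℤ; 1ℤ)

  lucas : ℤ → ℤ → ℕ → ℤ
  lucas P W zero          = 0ℤ
  lucas P W (suc zero)    = 1ℤ
  lucas P W (suc (suc k)) = P * lucas P W (suc k) - W * lucas P W k

module QuadraticAlgebraProperties (n : ℕ) (P W : ℤ) where

  open import Data.Nat.Base using (ℕ; zero; suc)
  open import Data.Integer.Base as ℤ using (ℤ; +_; 0ℤ; 1ℤ)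
  import Data.Integer.Properties as ℤ
  open import Data.Product using (_,_; proj₁; proj₂)
  open import Relation.Binary.PropositionalEquality as ≡ using (_≡_)
  open import Algebra.Bundles using (CommutativeRing)
  open import Data.Integer.Tactic.RingSolver using (solve-∀)
  open Congruence using (_≡_mod_)
  open import Data.Integer.Divisibility.Signed using (_∣_)
  open Lucas using (lucas)
  open QuadraticAlgebra n P W hiding (_≈_)
  open CommutativeRing A
  open import Algebra.Properties.Semiring.Exp semiring using (_^_)
  open import Algebra.Definitions.RawMonoid +-rawMonoid using (_×_)

  ι-cong : ∀ {a b} → a ≡ b mod n → ι a ≈ ι b
  ι-cong e = e & Mod.refl

  IsScalar : Elt → Set
  IsScalar x = proj₂ x ≡ 0ℤ mod n

  scalar⇒≈ι : ∀ x → IsScalar x → x ≈ ι (proj₁ x)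
  scalar⇒≈ι x s = Mod.refl & s

  ≈ι⇒scalar : ∀ {x c} → x ≈ ι c → IsScalar x
  ≈ι⇒scalar = proj₂≈

  scalar-resp : ∀ {x y} → x ≈ y → IsScalar x → IsScalar y
  scalar-resp e s = Mod.trans (Mod.sym (proj₂≈ e)) s

  conj-cong : ∀ {x y} → x ≈ y → conj x ≈ conj y
  conj-cong (e & f) = Mod.+-cong e (Mod.*-cong (Mod.refl {a = P}) f) & Mod.-‿cong f

  conj-ι : ∀ c → conj (ι c) ≈ ι c
  conj-ι c = ≡⇒≈ (≡.trans (≡.cong (ℤ._+_ c) (ℤ.*-zeroʳ P)) (ℤ.+-identityʳ c)) ≡.refl

  conj-α : conj α ≈ β
  conj-α = ≡⇒≈ (≡.trans (ℤ.+-identityˡ _) (ℤ.*-identityʳ P)) ≡.refl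

  opaque
    unfolding _⊕_ ⊝_ _⊗_

    ι-homo-+ : ∀ a b → ι a + ι b ≈ ι (a ℤ.+ b)
    ι-homo-+ a b = ≈-refl

    ι-homo-neg : ∀ a → - ι a ≈ ι (ℤ.- a)
    ι-homo-neg a = ≈-refl

    ι-scale : ∀ c a b → ι c * (a , b) ≈ (c ℤ.* a , c ℤ.* b)
    ι-scale c a b = ≡⇒≈ (scalar W c a b) (coeff P c a b)
      where
      scalar : ∀ W c a b → c ℤ.* a ℤ.- W ℤ.* (0ℤ ℤ.* b) ≡ c ℤ.* a
      scalar = solve-∀
      coeff : ∀ P c a b → c ℤ.* b ℤ.+ 0ℤ ℤ.* a ℤ.+ P ℤ.* (0ℤ ℤ.* b) ≡ c ℤ.* b
      coeff = solve-∀

    conj-homo-* : ∀ x y → conj (x * y) ≈ conj x * conj y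
    conj-homo-* (a , b) (c , d) = ≡⇒≈ (scalar P W a b c d) (coeff P a b c d)
      where
      scalar : ∀ P W a b c d → (a ℤ.* c ℤ.- W ℤ.* (b ℤ.* d)) ℤ.+ P ℤ.* (a ℤ.* d ℤ.+ b ℤ.* c ℤ.+ P ℤ.* (b ℤ.* d))
                             ≡ (a ℤ.+ P ℤ.* b) ℤ.* (c ℤ.+ P ℤ.* d) ℤ.- W ℤ.* ((ℤ.- b) ℤ.* (ℤ.- d))
      scalar = solve-∀
      coeff : ∀ P a b c d → ℤ.- (a ℤ.* d ℤ.+ b ℤ.* c ℤ.+ P ℤ.* (b ℤ.* d))
                            ≡ (a ℤ.+ P ℤ.* b) ℤ.* (ℤ.- d) ℤ.+ (ℤ.- b) ℤ.* (c ℤ.+ P ℤ.* d) ℤ.+ P ℤ.* ((ℤ.- b) ℤ.* (ℤ.- d))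
      coeff = solve-∀

    α*β≈ιW : α * β ≈ ι W
    α*β≈ιW = ≡⇒≈ (scalar P W) (coeff P)
      where
      scalar : ∀ P W → 0ℤ ℤ.* P ℤ.- W ℤ.* (1ℤ ℤ.* ℤ.- 1ℤ) ≡ W
      scalar = solve-∀
      coeff : ∀ P → 0ℤ ℤ.* ℤ.- 1ℤ ℤ.+ 1ℤ ℤ.* P ℤ.+ P ℤ.* (1ℤ ℤ.* ℤ.- 1ℤ) ≡ 0ℤ
      coeff = solve-∀

    x*conj[x]≈ι[norm] : ∀ x → x * conj x ≈ ι (norm x)
    x*conj[x]≈ι[norm] (a , b) = ≡⇒≈ (scalar P W a b) (coeff P a b)
      where
      scalar : ∀ P W a b → a ℤ.* (a ℤ.+ P ℤ.* b) ℤ.- W ℤ.* (b ℤ.* ℤ.- b)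
                           ≡ a ℤ.* a ℤ.+ P ℤ.* a ℤ.* b ℤ.+ W ℤ.* b ℤ.* b
      scalar = solve-∀
      coeff : ∀ P a b → a ℤ.* ℤ.- b ℤ.+ b ℤ.* (a ℤ.+ P ℤ.* b) ℤ.+ P ℤ.* (b ℤ.* ℤ.- b) ≡ 0ℤ
      coeff = solve-∀

    √Δ*√Δ≈ιΔ : √Δ * √Δ ≈ ι Δ
    √Δ*√Δ≈ιΔ = ≡⇒≈ (scalar P W) (coeff P)
      where
      scalar : ∀ P W → ℤ.- P ℤ.* ℤ.- P ℤ.- W ℤ.* (+ 2 ℤ.* + 2) ≡ P ℤ.* P ℤ.- + 4 ℤ.* W
      scalar = solve-∀
      coeff : ∀ P → ℤ.- P ℤ.* + 2 ℤ.+ + 2 ℤ.* ℤ.- P ℤ.+ P ℤ.* (+ 2 ℤ.* + 2) ≡ 0ℤ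
      coeff = solve-∀

    2α≈P+√Δ : ι (+ 2) * α ≈ ι P + √Δ
    2α≈P+√Δ = ≡⇒≈ (scalar P W) (coeff P)
      where
      scalar : ∀ P W → + 2 ℤ.* 0ℤ ℤ.- W ℤ.* (0ℤ ℤ.* 1ℤ) ≡ P ℤ.+ ℤ.- P
      scalar = solve-∀
      coeff : ∀ P → + 2 ℤ.* 1ℤ ℤ.+ 0ℤ ℤ.* 0ℤ ℤ.+ P ℤ.* (0ℤ ℤ.* 1ℤ) ≡ 0ℤ ℤ.+ + 2
      coeff = solve-∀

    2β≈P-√Δ : ι (+ 2) * β ≈ ι P - √Δ
    2β≈P-√Δ = ≡⇒≈ (scalar P W) (coeff P)
      where
      scalar : ∀ P W → + 2 ℤ.* P ℤ.- W ℤ.* (0ℤ ℤ.* ℤ.- 1ℤ) ≡ P ℤ.+ ℤ.- (ℤ.- P)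
      scalar = solve-∀
      coeff : ∀ P → + 2 ℤ.* ℤ.- 1ℤ ℤ.+ 0ℤ ℤ.* P ℤ.+ P ℤ.* (0ℤ ℤ.* ℤ.- 1ℤ) ≡ 0ℤ ℤ.+ ℤ.- + 2
      coeff = solve-∀

    α*⟨-Wu,v⟩ : ∀ u v → α * (ℤ.- (W ℤ.* u) , v) ≈ (ℤ.- (W ℤ.* v) , P ℤ.* v ℤ.- W ℤ.* u)
    α*⟨-Wu,v⟩ u v = ≡⇒≈ (scalar W u v) (coeff P W u v)
      where
      scalar : ∀ W u v → 0ℤ ℤ.* ℤ.- (W ℤ.* u) ℤ.- W ℤ.* (1ℤ ℤ.* v) ≡ ℤ.- (W ℤ.* v)
      scalar = solve-∀
      coeff : ∀ P W u v → 0ℤ ℤ.* v ℤ.+ 1ℤ ℤ.* ℤ.- (W ℤ.* u) ℤ.+ P ℤ.* (1ℤ ℤ.* v) ≡ P ℤ.* v ℤ.- W ℤ.* u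
      coeff = solve-∀

    ι-homo-* : ∀ a b → ι a * ι b ≈ ι (a ℤ.* b)
    ι-homo-* a b = ≈-trans (ι-scale a b 0ℤ) (≡⇒≈ ≡.refl (ℤ.*-zeroʳ a))

  ι-homo-^ : ∀ a k → ι a ^ k ≈ ι (a ℤ.^ k)
  ι-homo-^ a zero    = refl
  ι-homo-^ a (suc k) = trans (*-congˡ (ι-homo-^ a k)) (ι-homo-* a (a ℤ.^ k))

  ×1≈ι : ∀ k → k × 1# ≈ ι (+ k)
  ×1≈ι zero    = refl
  ×1≈ι (suc k) = trans (+-congˡ (×1≈ι k)) (ι-homo-+ 1ℤ (+ k))

  conj-homo-^ : ∀ x k → conj (x ^ k) ≈ conj x ^ k
  conj-homo-^ x zero    = conj-ι 1ℤ
  conj-homo-^ x (suc k) = trans (conj-homo-* x (x ^ k)) (*-congˡ (conj-homo-^ x k))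

  α^suc≈lucas : ∀ k → α ^ suc k ≈ (ℤ.- (W ℤ.* lucas P W k) , lucas P W (suc k))
  α^suc≈lucas zero    = trans (*-identityʳ α) (≡⇒≈ (≡.cong ℤ.-_ (≡.sym (ℤ.*-zeroʳ W))) ≡.refl)
  α^suc≈lucas (suc k) = trans (*-congˡ (α^suc≈lucas k)) (α*⟨-Wu,v⟩ (lucas P W k) (lucas P W (suc k)))

  scalar[α^k]⇒∣lucas : ∀ k → IsScalar (α ^ k) → + n ∣ lucas P W k
  scalar[α^k]⇒∣lucas zero    _ = Mod.≡0⇒∣ Mod.refl
  scalar[α^k]⇒∣lucas (suc k) s = Mod.≡0⇒∣ (Mod.trans (Mod.sym (proj₂≈ (α^suc≈lucas k))) s)

  ∣lucas⇒scalar[α^k] : ∀ k → + n ∣ lucas P W k → IsScalar (α ^ k)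
  ∣lucas⇒scalar[α^k] zero    _ = Mod.refl
  ∣lucas⇒scalar[α^k] (suc k) d = Mod.trans (proj₂≈ (α^suc≈lucas k)) (Mod.∣⇒≡0 d)

module CommutativeRingLemmas {c ℓ} (K : CommutativeRing c ℓ) where

  open import Data.Nat.Base as ℕ using (zero; suc)
  import Data.Nat.Properties as ℕ
  open CommutativeRing K
  open import Algebra.Properties.Ring ring using (-‿distribˡ-*; -‿distribʳ-*; -‿involutive)
  open import Algebra.Properties.AbelianGroup +-abelianGroup using (x∙y⁻¹≈ε⇒x≈y)
  open import Algebra.Properties.CommutativeSemiring.Exp commutativeSemiring
    using (_^_; ^-congˡ; ^-congʳ; ^-assocʳ; ^-distrib-*)
  open import Relation.Binary.Reasoning.Setoid setoid

  x-y≈0⇒x≈y : ∀ {x y} → x - y ≈ 0# → x ≈ y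
  x-y≈0⇒x≈y = x∙y⁻¹≈ε⇒x≈y _ _

  x≈y⇒x-y≈0 : ∀ {x y} → x ≈ y → x - y ≈ 0#
  x≈y⇒x-y≈0 {x} {y} e = trans (+-congʳ e) (-‿inverseʳ y)

  -x*-y≈x*y : ∀ x y → (- x) * (- y) ≈ x * y
  -x*-y≈x*y x y = begin
    (- x) * (- y) ≈⟨ -‿distribˡ-* x (- y) ⟨
    - (x * - y)   ≈⟨ -‿cong (-‿distribʳ-* x y) ⟨
    - (- (x * y)) ≈⟨ -‿involutive (x * y) ⟩
    x * y         ∎

  1^n≈1 : ∀ n → 1# ^ n ≈ 1#
  1^n≈1 zero    = refl
  1^n≈1 (suc n) = trans (*-identityˡ _) (1^n≈1 n)

  x^n≈1⇒x^[n*k]≈1 : ∀ {x} n k → x ^ n ≈ 1# → x ^ (n ℕ.* k) ≈ 1#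
  x^n≈1⇒x^[n*k]≈1 {x} n k e = trans (sym (^-assocʳ x n k)) (trans (^-congˡ k e) (1^n≈1 k))

  ^-comm : ∀ x a b → (x ^ a) ^ b ≈ (x ^ b) ^ a
  ^-comm x a b = trans (^-assocʳ x a b) (trans (^-congʳ x (ℕ.*-comm a b)) (sym (^-assocʳ x b a)))

  inverse-^ : ∀ {x y} n → x * y ≈ 1# → x ^ n * y ^ n ≈ 1#
  inverse-^ {x} {y} n e = trans (sym (^-distrib-* x y n)) (trans (^-congˡ n e) (1^n≈1 n))

  *-cancelʳ-invertible : ∀ {x y a b} → x * y ≈ 1# → a * x ≈ b * x → a ≈ b
  *-cancelʳ-invertible {x} {y} {a} {b} xy≈1 e = begin
    a           ≈⟨ *-identityʳ a ⟨
    a * 1#      ≈⟨ *-congˡ xy≈1 ⟨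
    a * (x * y) ≈⟨ *-assoc a x y ⟨
    (a * x) * y ≈⟨ *-congʳ e ⟩
    (b * x) * y ≈⟨ *-assoc b x y ⟩
    b * (x * y) ≈⟨ *-congˡ xy≈1 ⟩
    b * 1#      ≈⟨ *-identityʳ b ⟩
    b           ∎

module PrimeBinomial where

  open import Data.Nat.Base using (ℕ; zero; suc; _!; _∸_; _*_; _<_; NonZero)
  open import Data.Nat.Properties using (<⇒≱; <-trans; n<1+n; <⇒≤; ∸-monoʳ-<; _!*_!≢0)
  open import Data.Nat.Combinatorics using (_C_; nCk≡n!/k![n-k]!; k![n∸k]!∣n!)
  open import Data.Nat.DivMod using (m/n*n≡m)
  open import Data.Nat.Divisibility using (_∣_; ∣1⇒≡1; ∣⇒≤; m∣m*n)
  open import Data.Nat.Primality using (Prime; euclidsLemma; prime⇒nonTrivial; prime⇒nonZero)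
  open import Data.Nat.Base using (nonTrivial⇒≢1)
  open import Data.Sum using (inj₁; inj₂)
  open import Data.Empty using (⊥-elim)
  open import Relation.Nullary using (¬_)
  open import Relation.Binary.PropositionalEquality using (cong; subst; sym; trans)

  n∣n! : ∀ n → .{{NonZero n}} → n ∣ n !
  n∣n! (suc n) = m∣m*n (n !)

  module _ {p : ℕ} (p-prime : Prime p) where

    private instance
      _ = prime⇒nonZero p-prime

    prime∤n! : ∀ n → n < p → ¬ p ∣ n !
    prime∤n! zero    _   d = nonTrivial⇒≢1 {{prime⇒nonTrivial p-prime}} (∣1⇒≡1 d)
    prime∤n! (suc n) n<p d with euclidsLemma (suc n) (n !) p-prime d
    ... | inj₁ p∣n+1 = <⇒≱ n<p (∣⇒≤ p∣n+1)
    ... | inj₂ p∣n!  = prime∤n! n (<-trans (n<1+n n) n<p) p∣n!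

    prime∣choose : ∀ k → 0 < k → k < p → p ∣ p C k
    prime∣choose k 0<k k<p with euclidsLemma (p C k) (k ! * (p ∸ k) !) p-prime p∣C*k!*[p-k]!
      where
      instance _ = k !* (p ∸ k) !≢0
      p∣C*k!*[p-k]! : p ∣ (p C k) * (k ! * (p ∸ k) !)
      p∣C*k!*[p-k]! = subst (p ∣_)
        (sym (trans (cong (_* (k ! * (p ∸ k) !)) (nCk≡n!/k![n-k]! (<⇒≤ k<p))) (m/n*n≡m (k![n∸k]!∣n! (<⇒≤ k<p)))))
        (n∣n! p)
    ... | inj₁ p∣C = p∣C
    ... | inj₂ p∣k!*[p-k]! with euclidsLemma (k !) ((p ∸ k) !) p-prime p∣k!*[p-k]!
    ...   | inj₁ p∣k!     = ⊥-elim (prime∤n! k k<p p∣k!)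
    ...   | inj₂ p∣[p-k]! = ⊥-elim (prime∤n! (p ∸ k) (∸-monoʳ-< 0<k (<⇒≤ k<p)) p∣[p-k]!)

module Frobenius {c ℓ} (K : CommutativeRing c ℓ) {p : ℕ} (p-prime : Prime p) where

  open import Data.Nat.Base as ℕ using (zero; suc; s≤s; z≤n)
  import Data.Nat.Properties as ℕ
  open import Data.Nat.Combinatorics using (nCn≡1)
  open import Data.Nat.Divisibility using (_∣_; divides)
  open import Data.Fin.Base using (Fin; zero; suc; fromℕ; inject₁)
  open import Data.Fin.Properties using (toℕ-inject₁; toℕ-fromℕ; toℕ<n)
  open import Relation.Binary.PropositionalEquality as ≡ using (_≡_)
  open CommutativeRing K hiding (zero)
  open import Algebra.Properties.CommutativeSemiring.Binomial commutativeSemiring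
    using (theorem; binomialTerm)
  open import Algebra.Properties.CommutativeSemiring.Exp commutativeSemiring using (_^_)
  open import Algebra.Properties.Monoid.Mult +-monoid using (_×_; ×-congʳ; ×-congˡ; ×-assocˡ)
  open import Algebra.Properties.Semiring.Mult semiring using (×-assoc-*)
  open import Algebra.Definitions.RawMonoid +-rawMonoid using (sum)
  open import Relation.Binary.Reasoning.Setoid setoid
  open PrimeBinomial using (prime∣choose)

  module _ (char-p : p × 1# ≈ 0#) where

    p×x≈0 : ∀ x → p × x ≈ 0#
    p×x≈0 x = begin
      p × x        ≈⟨ ×-congʳ p (*-identityˡ x) ⟨
      p × (1# * x) ≈⟨ ×-assoc-* p 1# x ⟨
      (p × 1#) * x ≈⟨ *-congʳ char-p ⟩
      0# * x       ≈⟨ zeroˡ x ⟩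
      0#           ∎

    n×0≈0 : ∀ n → n × 0# ≈ 0#
    n×0≈0 zero    = refl
    n×0≈0 (suc n) = trans (+-congˡ (n×0≈0 n)) (+-identityˡ 0#)

    p∣n⇒n×x≈0 : ∀ {n} x → p ∣ n → n × x ≈ 0#
    p∣n⇒n×x≈0 {n} x (divides q n≡q*p) = begin
      n × x         ≈⟨ ×-congˡ n≡q*p ⟩
      (q ℕ.* p) × x ≈⟨ ×-assocˡ x q p ⟨
      q × (p × x)   ≈⟨ ×-congʳ q (p×x≈0 x) ⟩
      q × 0#        ≈⟨ n×0≈0 q ⟩
      0#            ∎

    sum≈last : ∀ m (t : Fin (suc m) → Carrier) → (∀ i → t (inject₁ i) ≈ 0#) → sum t ≈ t (fromℕ m)
    sum≈last zero    t t≈0 = +-identityʳ (t zero)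
    sum≈last (suc m) t t≈0 =
      trans (+-cong (t≈0 zero) (sum≈last m (λ i → t (suc i)) (λ i → t≈0 (suc i)))) (+-identityˡ _)

    frobenius : ∀ x y → (x + y) ^ p ≈ x ^ p + y ^ p
    frobenius x y = expand p ≡.refl
      where
      -- no case n = 0: the context then contains an element of the empty type Prime 0
      expand : ∀ n → n ≡ p → (x + y) ^ n ≈ x ^ n + y ^ n
      expand (suc m) ≡.refl = begin
        (x + y) ^ suc m                ≈⟨ theorem (suc m) x y ⟩
        T zero + sum (λ i → T (suc i)) ≈⟨ +-cong first (sum≈last m (λ i → T (suc i)) middle) ⟩
        y ^ suc m + T (suc (fromℕ m))  ≈⟨ +-congˡ last ⟩
        y ^ suc m + x ^ suc m          ≈⟨ +-comm _ _ ⟩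
        x ^ suc m + y ^ suc m          ∎
        where
        T = binomialTerm x y (suc m)
        first : T zero ≈ y ^ suc m
        first = trans (+-identityʳ _) (*-identityˡ _)
        middle : ∀ (i : Fin m) → T (suc (inject₁ i)) ≈ 0#
        middle i = p∣n⇒n×x≈0 _ (prime∣choose p-prime _ (s≤s z≤n)
                     (s≤s (≡.subst (ℕ._< m) (≡.sym (toℕ-inject₁ i)) (toℕ<n i))))
        last : T (suc (fromℕ m)) ≈ x ^ suc m
        last rewrite toℕ-fromℕ m | nCn≡1 (suc m) | ℕ.n∸n≡0 m = trans (+-identityʳ _) (*-identityʳ _)

module MonicPolynomial {c ℓ} (K : CommutativeRing c ℓ) where

  open import Data.Nat.Base as ℕ using (zero; suc)
  import Data.Nat.Properties as ℕ
  open import Data.List.Base using (List; []; _∷_; length; replicate)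
  open import Data.List.Relation.Unary.All as All using (All; []; _∷_)
  open import Data.List.Relation.Unary.AllPairs using (AllPairs; []; _∷_)
  open import Data.Product using (_,_)
  open import Relation.Binary.PropositionalEquality as ≡ using (_≡_)
  open import Algebra.Definitions using (AlmostLeftCancellative)
  open CommutativeRing K
  open import Algebra.Properties.Ring ring using ([y-z]x≈yx-zx; x[y-z]≈xy-xz)
  open import Algebra.Properties.CommutativeSemigroup *-commutativeSemigroup using (x∙yz≈y∙xz)
  open import Algebra.Properties.CommutativeSemiring.Exp commutativeSemiring using (_^_)
  open import Algebra.Definitions.RawMonoid +-rawMonoid using (_×_)
  open import Relation.Binary.Reasoning.Setoid setoid
  import Algebra.Solver.CommutativeMonoid +-commutativeMonoid as +-Solver
  open CommutativeRingLemmas K using (x-y≈0⇒x≈y)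

  -- c₀ ∷ c₁ ∷ … ∷ cₙ₋₁ ∷ [] encodes the monic polynomial c₀ + c₁ x + … + cₙ₋₁ xⁿ⁻¹ + xⁿ.
  evalMonic : List Carrier → Carrier → Carrier
  evalMonic []       x = 1#
  evalMonic (c ∷ cs) x = c + x * evalMonic cs x

  ∏[x-r] : List Carrier → Carrier → Carrier
  ∏[x-r] []       x = 1#
  ∏[x-r] (r ∷ rs) x = (x - r) * ∏[x-r] rs x

  record Division : Set c where
    field
      quotient  : List Carrier
      remainder : Carrier
  open Division

  divide : Carrier → Carrier → List Carrier → Division
  divide r c₀ []        = record { quotient = [] ; remainder = c₀ + r }
  divide r c₀ (c₁ ∷ cs) = record { quotient = remainder d ∷ quotient d ; remainder = c₀ + r * remainder d }
    where d = divide r c₁ cs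

  length-quotient : ∀ r c₀ cs → length (quotient (divide r c₀ cs)) ≡ length cs
  length-quotient r c₀ []        = ≡.refl
  length-quotient r c₀ (c₁ ∷ cs) = ≡.cong suc (length-quotient r c₁ cs)

  divide-correct : ∀ r c₀ cs x →
    c₀ + x * evalMonic cs x ≈ (x - r) * evalMonic (quotient (divide r c₀ cs)) x + remainder (divide r c₀ cs)
  divide-correct r c₀ [] x = begin
    c₀ + x * 1#             ≈⟨ +-congˡ (*-identityʳ x) ⟩
    c₀ + x                  ≈⟨ +-congˡ (+-identityʳ x) ⟨
    c₀ + (x + 0#)           ≈⟨ +-congˡ (+-congˡ (-‿inverseʳ r)) ⟨
    c₀ + (x + (r - r))      ≈⟨ +-Solver.solve 4 (λ c x r r⁻ → c ⊕ (x ⊕ (r ⊕ r⁻)) ⊜ (x ⊕ r⁻) ⊕ (c ⊕ r)) refl c₀ x r (- r) ⟩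
    (x - r) + (c₀ + r)      ≈⟨ +-congʳ (*-identityʳ (x - r)) ⟨
    (x - r) * 1# + (c₀ + r) ∎
    where open +-Solver using (_⊕_; _⊜_)
  divide-correct r c₀ (c₁ ∷ cs) x = begin
    c₀ + x * (c₁ + x * evalMonic cs x)      ≈⟨ +-congˡ (*-congˡ (divide-correct r c₁ cs x)) ⟩
    c₀ + x * ((x - r) * E + R)              ≈⟨ +-congˡ (distribˡ x _ R) ⟩
    c₀ + (x * ((x - r) * E) + x * R)        ≈⟨ +-congˡ (+-congˡ (+-identityʳ (x * R))) ⟨
    c₀ + (x * ((x - r) * E) + (x * R + 0#)) ≈⟨ +-congˡ (+-congˡ (+-congˡ (-‿inverseʳ (r * R)))) ⟨
    c₀ + (x * ((x - r) * E) + (x * R + (r * R - r * R)))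
      ≈⟨ +-Solver.solve 5 (λ c a xR rR rR⁻ → c ⊕ (a ⊕ (xR ⊕ (rR ⊕ rR⁻))) ⊜ ((xR ⊕ rR⁻) ⊕ a) ⊕ (c ⊕ rR))
                          refl c₀ (x * ((x - r) * E)) (x * R) (r * R) (- (r * R)) ⟩
    ((x * R - r * R) + x * ((x - r) * E)) + (c₀ + r * R)
      ≈⟨ +-congʳ (+-cong ([y-z]x≈yx-zx R x r) (x∙yz≈y∙xz (x - r) x E)) ⟨
    ((x - r) * R + (x - r) * (x * E)) + (c₀ + r * R) ≈⟨ +-congʳ (distribˡ (x - r) R (x * E)) ⟨
    (x - r) * (R + x * E) + (c₀ + r * R)        ∎
    where
    open +-Solver using (_⊕_; _⊜_)
    E = evalMonic (quotient (divide r c₁ cs)) x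
    R = remainder (divide r c₁ cs)

  module _ (cancel : AlmostLeftCancellative _≈_ 0# _*_) where

    x*y≈0⇒y≈0 : ∀ {x y} → x ≉ 0# → x * y ≈ 0# → y ≈ 0#
    x*y≈0⇒y≈0 {x} {y} x≉0 xy≈0 = cancel x y 0# x≉0 (trans xy≈0 (sym (zeroʳ x)))

    evalMonic≈∏[x-r] : ∀ rs cs → length cs ≡ length rs → AllPairs _≉_ rs →
                       All (λ r → evalMonic cs r ≈ 0#) rs → ∀ x → evalMonic cs x ≈ ∏[x-r] rs x
    evalMonic≈∏[x-r] []       []        _   _                   _              x = refl
    evalMonic≈∏[x-r] (r ∷ rs) (c₀ ∷ cs) len (r≉rs ∷ rs-distinct) (r-root ∷ rs-roots) x = begin
      c₀ + x * evalMonic cs x      ≈⟨ divide-correct r c₀ cs x ⟩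
      (x - r) * evalMonic Q x + R  ≈⟨ +-congˡ R≈0 ⟩
      (x - r) * evalMonic Q x + 0# ≈⟨ +-identityʳ _ ⟩
      (x - r) * evalMonic Q x      ≈⟨ *-congˡ (evalMonic≈∏[x-r] rs Q len′ rs-distinct Q-roots x) ⟩
      (x - r) * ∏[x-r] rs x        ∎
      where
      Q = quotient (divide r c₀ cs)
      R = remainder (divide r c₀ cs)
      len′ : length Q ≡ length rs
      len′ = ≡.trans (length-quotient r c₀ cs) (ℕ.suc-injective len)
      at-root : ∀ {y} → evalMonic (c₀ ∷ cs) y ≈ 0# → (y - r) * evalMonic Q y + R ≈ 0#
      at-root e = trans (sym (divide-correct r c₀ cs _)) e
      R≈0 : R ≈ 0#
      R≈0 = begin
        R                           ≈⟨ +-identityˡ R ⟨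
        0# + R                      ≈⟨ +-congʳ (zeroˡ _) ⟨
        0# * evalMonic Q r + R      ≈⟨ +-congʳ (*-congʳ (-‿inverseʳ r)) ⟨
        (r - r) * evalMonic Q r + R ≈⟨ at-root r-root ⟩
        0#                          ∎
      Q-roots : All (λ y → evalMonic Q y ≈ 0#) rs
      Q-roots = All.zipWith (λ (r≉y , y-root) → x*y≈0⇒y≈0 (λ y-r≈0 → r≉y (sym (x-y≈0⇒x≈y y-r≈0)))
                               (trans (sym (+-identityʳ _)) (trans (+-congˡ (sym R≈0)) (at-root y-root))))
                            (r≉rs , rs-roots)

  geometric-sum : ∀ n x → (x - 1#) * evalMonic (replicate n 1#) x ≈ x ^ suc n - 1#
  geometric-sum zero    x = trans (*-identityʳ _) (+-congʳ (sym (*-identityʳ x)))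
  geometric-sum (suc n) x = begin
    (x - 1#) * (1# + x * E)            ≈⟨ distribˡ (x - 1#) 1# (x * E) ⟩
    (x - 1#) * 1# + (x - 1#) * (x * E) ≈⟨ +-cong (*-identityʳ _) (x∙yz≈y∙xz (x - 1#) x E) ⟩
    (x - 1#) + x * ((x - 1#) * E)      ≈⟨ +-congˡ (*-congˡ (geometric-sum n x)) ⟩
    (x - 1#) + x * (X - 1#)            ≈⟨ +-congˡ (x[y-z]≈xy-xz x X 1#) ⟩
    (x - 1#) + (x * X - x * 1#)        ≈⟨ +-congˡ (+-congˡ (-‿cong (*-identityʳ x))) ⟩
    (x - 1#) + (x * X - x)
      ≈⟨ +-Solver.solve 4 (λ x m1 xX mx → (x ⊕ m1) ⊕ (xX ⊕ mx) ⊜ (xX ⊕ m1) ⊕ (x ⊕ mx)) refl x (- 1#) (x * X) (- x) ⟩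
    (x * X - 1#) + (x - x) ≈⟨ +-congˡ (-‿inverseʳ x) ⟩
    (x * X - 1#) + 0#      ≈⟨ +-identityʳ _ ⟩
    x * X - 1#             ∎
    where
    open +-Solver using (_⊕_; _⊜_)
    E = evalMonic (replicate n 1#) x
    X = x ^ suc n

  evalMonic[ones]-at-1 : ∀ n → evalMonic (replicate n 1#) 1# ≈ suc n × 1#
  evalMonic[ones]-at-1 zero    = sym (+-identityʳ 1#)
  evalMonic[ones]-at-1 (suc n) = +-congˡ (trans (*-identityˡ _) (evalMonic[ones]-at-1 n))

module RootsOfUnity {c ℓ} (K : CommutativeRing c ℓ) where

  open import Data.Nat.Base as ℕ using (zero; suc; _<_; _≤_; s≤s; z≤n)
  import Data.Nat.Properties as ℕ
  open import Data.List.Base using (List; []; _∷_; length; replicate)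
  open import Data.List.Properties using (length-replicate)
  open import Data.List.Relation.Unary.All using (All; []; _∷_)
  open import Data.List.Relation.Unary.AllPairs using (AllPairs; []; _∷_)
  open import Data.Product as Product using (_,_; proj₁; proj₂)
  open import Relation.Binary.PropositionalEquality as ≡ using (_≡_)
  open import Algebra.Definitions using (AlmostLeftCancellative)
  open CommutativeRing K hiding (zero)
  open import Relation.Binary.Properties.Setoid setoid using (≉-sym)
  open import Algebra.Properties.Ring ring using (-1*x≈-x; -‿distribˡ-*; x[y-z]≈xy-xz)
  open import Algebra.Properties.AbelianGroup +-abelianGroup using (⁻¹-anti-homo‿-)
  open import Algebra.Properties.CommutativeSemigroup *-commutativeSemigroup using (interchange)
  open import Algebra.Properties.CommutativeSemiring.Exp commutativeSemiring
    using (_^_; ^-congˡ; ^-congʳ; ^-homo-*; ^-assocʳ; ^-distrib-*)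
  open import Algebra.Definitions.RawMonoid +-rawMonoid using (_×_)
  open import Relation.Binary.Reasoning.Setoid setoid
  open CommutativeRingLemmas K
  open MonicPolynomial K

  record IsPrimitiveRoot (q : ℕ) (x : Carrier) : Set ℓ where
    field
      root      : x ^ q ≈ 1#
      minimal   : ∀ b → 0 < b → b < q → x ^ b ≉ 1#

  module _ {r : ℕ} {x : Carrier} (x-primitive : IsPrimitiveRoot (suc r) x) where
    open IsPrimitiveRoot x-primitive

    x^a*x⁻^a≈1 : ∀ a → x ^ a * (x ^ r) ^ a ≈ 1#
    x^a*x⁻^a≈1 a = inverse-^ a root

    ^-injective : ∀ {a b} → a < b → b < suc r → x ^ a ≉ x ^ b
    ^-injective {a} {b} a<b b<q x^a≈x^b = minimal d 0<d d<q (sym (*-cancelʳ-invertible (x^a*x⁻^a≈1 a) (begin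
      1# * x ^ a    ≈⟨ *-identityˡ _ ⟩
      x ^ a         ≈⟨ x^a≈x^b ⟩
      x ^ b         ≈⟨ ^-congʳ x (ℕ.m+[n∸m]≡n (ℕ.<⇒≤ a<b)) ⟨
      x ^ (a ℕ.+ d) ≈⟨ ^-homo-* x a d ⟩
      x ^ a * x ^ d ≈⟨ *-comm _ _ ⟩
      x ^ d * x ^ a ∎)))
      where
      d = b ℕ.∸ a
      0<d : 0 < d
      0<d = ℕ.m<n⇒0<n∸m a<b
      d<q : d < suc r
      d<q = ℕ.≤-<-trans (ℕ.m∸n≤m b a) b<q

    x^a≉x⁻^b : ∀ a b → 0 < a ℕ.+ b → a ℕ.+ b < suc r → x ^ a ≉ (x ^ r) ^ b
    x^a≉x⁻^b a b 0<a+b a+b<q x^a≈x⁻^b = minimal (a ℕ.+ b) 0<a+b a+b<q (begin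
      x ^ (a ℕ.+ b)       ≈⟨ ^-homo-* x a b ⟩
      x ^ a * x ^ b       ≈⟨ *-congʳ x^a≈x⁻^b ⟩
      (x ^ r) ^ b * x ^ b ≈⟨ *-comm _ _ ⟩
      x ^ b * (x ^ r) ^ b ≈⟨ x^a*x⁻^a≈1 b ⟩
      1#                  ∎)

    inverse-primitive : IsPrimitiveRoot (suc r) (x ^ r)
    inverse-primitive = record
      { root      = trans (^-comm x r (suc r)) (trans (^-congˡ r root) (1^n≈1 r))
      ; minimal   = λ b 0<b b<q x⁻^b≈1 → minimal b 0<b b<q (begin
          x ^ b               ≈⟨ *-identityʳ _ ⟨
          x ^ b * 1#          ≈⟨ *-congˡ x⁻^b≈1 ⟨
          x ^ b * (x ^ r) ^ b ≈⟨ x^a*x⁻^a≈1 b ⟩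
          1#                  ∎)
      }

    root-^ : ∀ j → (x ^ j) ^ suc r ≈ 1#
    root-^ j = trans (^-comm x j (suc r)) (trans (^-congˡ j root) (1^n≈1 j))

    √-of-root : ∀ h → r ≡ h ℕ.+ h → x ^ suc h * x ^ suc h ≈ x
    √-of-root h ≡.refl = begin
      x ^ suc h * x ^ suc h ≈⟨ ^-homo-* x (suc h) (suc h) ⟨
      x ^ (suc h ℕ.+ suc h) ≈⟨ ^-congʳ x (≡.cong suc (ℕ.+-suc h h)) ⟩
      x * x ^ suc r         ≈⟨ *-congˡ root ⟩
      x * 1#                ≈⟨ *-identityʳ x ⟩
      x                     ∎

  module _ (cancel : AlmostLeftCancellative _≈_ 0# _*_)
           {h : ℕ} {η : Carrier} (η-primitive : IsPrimitiveRoot (suc (h ℕ.+ h)) η) where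

    private
      q : ℕ
      q = suc (h ℕ.+ h)

      bound : ∀ {a b} → a ≤ h → b ≤ h → a ℕ.+ b < q
      bound a≤h b≤h = s≤s (ℕ.+-mono-≤ a≤h b≤h)

      bound₁ : ∀ {a} → a ≤ h → a < q
      bound₁ a≤h = s≤s (ℕ.≤-trans a≤h (ℕ.m≤m+n h h))

    η⁻ : Carrier
    η⁻ = η ^ (h ℕ.+ h)

    η⁻-primitive : IsPrimitiveRoot q η⁻
    η⁻-primitive = inverse-primitive η-primitive

    conjugatePairs : ℕ → List Carrier
    conjugatePairs zero    = []
    conjugatePairs (suc k) = η ^ suc k ∷ η⁻ ^ suc k ∷ conjugatePairs k

    length-conjugatePairs : ∀ k → length (conjugatePairs k) ≡ k ℕ.+ k
    length-conjugatePairs zero    = ≡.refl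
    length-conjugatePairs (suc k) = ≡.cong suc (≡.trans (≡.cong suc (length-conjugatePairs k)) (≡.sym (ℕ.+-suc k k)))

    All-conjugatePairs : ∀ (P : Carrier → Set ℓ) k → (∀ j → j < k → P (η ^ suc j) Product.× P (η⁻ ^ suc j)) →
                         All P (conjugatePairs k)
    All-conjugatePairs P zero    f = []
    All-conjugatePairs P (suc k) f =
      proj₁ (f k (ℕ.n<1+n k)) ∷ proj₂ (f k (ℕ.n<1+n k)) ∷ All-conjugatePairs P k (λ j j<k → f j (ℕ.m<n⇒m<1+n j<k))

    conjugatePairs-distinct : ∀ k → k ≤ h → AllPairs _≉_ (conjugatePairs k)
    conjugatePairs-distinct zero    _    = []
    conjugatePairs-distinct (suc k) k<h =
      (x^a≉x⁻^b η-primitive (suc k) (suc k) (s≤s z≤n) (bound k<h k<h)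
        ∷ All-conjugatePairs _ k (λ j j<k →
            ≉-sym (^-injective η-primitive (s≤s j<k) (bound₁ k<h))
          , x^a≉x⁻^b η-primitive (suc k) (suc j) (s≤s z≤n) (bound k<h (j<h j<k))))
      ∷ All-conjugatePairs _ k (λ j j<k →
            ≉-sym (x^a≉x⁻^b η-primitive (suc j) (suc k) (s≤s z≤n) (bound (j<h j<k) k<h))
          , ≉-sym (^-injective η⁻-primitive (s≤s j<k) (bound₁ k<h)))
      ∷ conjugatePairs-distinct k (ℕ.<⇒≤ k<h)
      where
      j<h : ∀ {j} → j < k → suc j ≤ h
      j<h j<k = ℕ.≤-trans j<k (ℕ.<⇒≤ k<h)

    -- 1 + x + … + x^(q-1)
    cyclotomic : List Carrier
    cyclotomic = replicate (h ℕ.+ h) 1#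

    cyclotomic-root : ∀ ζ → ζ ^ q ≈ 1# → ζ ≉ 1# → evalMonic cyclotomic ζ ≈ 0#
    cyclotomic-root ζ ζ^q≈1 ζ≉1 = x*y≈0⇒y≈0 cancel (λ e → ζ≉1 (x-y≈0⇒x≈y e))
                                     (trans (geometric-sum (h ℕ.+ h) ζ) (x≈y⇒x-y≈0 ζ^q≈1))

    q×1≈∏[1-ζ] : q × 1# ≈ ∏[x-r] (conjugatePairs h) 1#
    q×1≈∏[1-ζ] = trans (sym (evalMonic[ones]-at-1 (h ℕ.+ h)))
      (evalMonic≈∏[x-r] cancel (conjugatePairs h) cyclotomic
        (≡.trans (length-replicate (h ℕ.+ h)) (≡.sym (length-conjugatePairs h)))
        (conjugatePairs-distinct h ℕ.≤-refl)
        (All-conjugatePairs _ h (λ j j<h →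
            cyclotomic-root _ (root-^ η-primitive (suc j))
                              (IsPrimitiveRoot.minimal η-primitive (suc j) (s≤s z≤n) (bound₁ j<h))
          , cyclotomic-root _ (root-^ η⁻-primitive (suc j))
                              (IsPrimitiveRoot.minimal η⁻-primitive (suc j) (s≤s z≤n) (bound₁ j<h))))
        1#)

    module _ {i : Carrier} (i*i≈-1 : i * i ≈ - 1#) where

      ρ ρ⁻ : Carrier
      ρ  = η ^ suc h
      ρ⁻ = η⁻ ^ suc h

      ρ*ρ⁻≈1 : ρ * ρ⁻ ≈ 1#
      ρ*ρ⁻≈1 = x^a*x⁻^a≈1 η-primitive (suc h)

      ρ⁻*ρ≈1 : ρ⁻ * ρ ≈ 1#
      ρ⁻*ρ≈1 = trans (*-comm ρ⁻ ρ) ρ*ρ⁻≈1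

      [i[a-b]]²≈[1-a²][1-b²] : ∀ {a b} → a * b ≈ 1# →
                               (i * (a - b)) * (i * (a - b)) ≈ (1# - a * a) * (1# - b * b)
      [i[a-b]]²≈[1-a²][1-b²] {a} {b} ab≈1 = begin
        (i * (a - b)) * (i * (a - b))     ≈⟨ interchange i (a - b) i (a - b) ⟩
        (i * i) * ((a - b) * (a - b))     ≈⟨ *-congʳ i*i≈-1 ⟩
        - 1# * ((a - b) * (a - b))        ≈⟨ -1*x≈-x _ ⟩
        - ((a - b) * (a - b))             ≈⟨ -‿distribˡ-* (a - b) (a - b) ⟩
        (- (a - b)) * (a - b)             ≈⟨ *-congʳ (⁻¹-anti-homo‿- a b) ⟩
        (b - a) * (a - b)                 ≈⟨ *-identityˡ _ ⟨
        1# * ((b - a) * (a - b))          ≈⟨ *-congʳ ab≈1 ⟨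
        (a * b) * ((b - a) * (a - b))     ≈⟨ interchange a (b - a) b (a - b) ⟨
        (a * (b - a)) * (b * (a - b))     ≈⟨ *-cong (x[y-z]≈xy-xz a b a) (x[y-z]≈xy-xz b a b) ⟩
        (a * b - a * a) * (b * a - b * b) ≈⟨ *-cong (+-congʳ ab≈1) (+-congʳ (trans (*-comm b a) ab≈1)) ⟩
        (1# - a * a) * (1# - b * b)       ∎

      -- the product formula for the quadratic Gauss sum of q
      gaussProduct : ℕ → Carrier
      gaussProduct zero    = 1#
      gaussProduct (suc k) = (i * (ρ ^ suc k - ρ⁻ ^ suc k)) * gaussProduct k

      gaussProduct-square : ∀ k → gaussProduct k * gaussProduct k ≈ ∏[x-r] (conjugatePairs k) 1#
      gaussProduct-square zero    = *-identityʳ 1#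
      gaussProduct-square (suc k) = begin
        (g * gaussProduct k) * (g * gaussProduct k)                           ≈⟨ interchange _ _ _ _ ⟩
        (g * g) * (gaussProduct k * gaussProduct k)                           ≈⟨ *-cong g² (gaussProduct-square k) ⟩
        ((1# - η ^ suc k) * (1# - η⁻ ^ suc k)) * ∏[x-r] (conjugatePairs k) 1# ≈⟨ *-assoc _ _ _ ⟩
        ∏[x-r] (conjugatePairs (suc k)) 1#                                    ∎
        where
        g = i * (ρ ^ suc k - ρ⁻ ^ suc k)
        square : ∀ {x y} → x * x ≈ y → x ^ suc k * x ^ suc k ≈ y ^ suc k
        square {x} x²≈y = trans (sym (^-distrib-* x x (suc k))) (^-congˡ (suc k) x²≈y)
        g² : g * g ≈ (1# - η ^ suc k) * (1# - η⁻ ^ suc k)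
        g² = trans ([i[a-b]]²≈[1-a²][1-b²] (inverse-^ (suc k) ρ*ρ⁻≈1))
               (*-cong (+-congˡ (-‿cong (square (√-of-root η-primitive h ≡.refl))))
                       (+-congˡ (-‿cong (square (√-of-root η⁻-primitive h ≡.refl)))))

      gaussProduct²≈q : gaussProduct h * gaussProduct h ≈ q × 1#
      gaussProduct²≈q = trans (gaussProduct-square h) (sym q×1≈∏[1-ζ])

      module _ {p : ℕ} (frobenius-sub : ∀ x y → (x - y) ^ p ≈ x ^ p - y ^ p)
               (η^p*η≈1 : η ^ p * η ≈ 1#) (i^p≈-i : i ^ p ≈ - i) where

        ρ^p≈ρ⁻ : ρ ^ p ≈ ρ⁻
        ρ^p≈ρ⁻ = *-cancelʳ-invertible ρ*ρ⁻≈1 (begin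
          ρ ^ p * ρ                   ≈⟨ *-congʳ (^-comm η (suc h) p) ⟩
          (η ^ p) ^ suc h * η ^ suc h ≈⟨ ^-distrib-* (η ^ p) η (suc h) ⟨
          (η ^ p * η) ^ suc h         ≈⟨ ^-congˡ (suc h) η^p*η≈1 ⟩
          1# ^ suc h                  ≈⟨ 1^n≈1 (suc h) ⟩
          1#                          ≈⟨ ρ⁻*ρ≈1 ⟨
          ρ⁻ * ρ                      ∎)

        ρ⁻^p≈ρ : ρ⁻ ^ p ≈ ρ
        ρ⁻^p≈ρ = *-cancelʳ-invertible ρ⁻*ρ≈1 (begin
          ρ⁻ ^ p * ρ⁻    ≈⟨ *-congˡ ρ^p≈ρ⁻ ⟨
          ρ⁻ ^ p * ρ ^ p ≈⟨ ^-distrib-* ρ⁻ ρ p ⟨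
          (ρ⁻ * ρ) ^ p   ≈⟨ ^-congˡ p ρ⁻*ρ≈1 ⟩
          1# ^ p         ≈⟨ 1^n≈1 p ⟩
          1#             ≈⟨ ρ*ρ⁻≈1 ⟨
          ρ * ρ⁻         ∎)

        [ρ^j-ρ⁻^j]^p : ∀ j → (ρ ^ j - ρ⁻ ^ j) ^ p ≈ - (ρ ^ j - ρ⁻ ^ j)
        [ρ^j-ρ⁻^j]^p j = begin
          (ρ ^ j - ρ⁻ ^ j) ^ p       ≈⟨ frobenius-sub (ρ ^ j) (ρ⁻ ^ j) ⟩
          (ρ ^ j) ^ p - (ρ⁻ ^ j) ^ p ≈⟨ +-cong (^-comm ρ j p) (-‿cong (^-comm ρ⁻ j p)) ⟩
          (ρ ^ p) ^ j - (ρ⁻ ^ p) ^ j ≈⟨ +-cong (^-congˡ j ρ^p≈ρ⁻) (-‿cong (^-congˡ j ρ⁻^p≈ρ)) ⟩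
          ρ⁻ ^ j - ρ ^ j             ≈⟨ ⁻¹-anti-homo‿- (ρ ^ j) (ρ⁻ ^ j) ⟨
          - (ρ ^ j - ρ⁻ ^ j)         ∎

        gaussProduct^p : ∀ k → gaussProduct k ^ p ≈ gaussProduct k
        gaussProduct^p zero    = 1^n≈1 p
        gaussProduct^p (suc k) = begin
          ((i * w) * gaussProduct k) ^ p   ≈⟨ ^-distrib-* _ _ p ⟩
          (i * w) ^ p * gaussProduct k ^ p ≈⟨ *-cong (^-distrib-* i w p) (gaussProduct^p k) ⟩
          (i ^ p * w ^ p) * gaussProduct k ≈⟨ *-congʳ (*-cong i^p≈-i ([ρ^j-ρ⁻^j]^p (suc k))) ⟩
          (- i * - w) * gaussProduct k     ≈⟨ *-congʳ (-x*-y≈x*y i w) ⟩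
          (i * w) * gaussProduct k         ∎
          where w = ρ ^ suc k - ρ⁻ ^ suc k

module QuadraticAlgebraModPrime {p : ℕ} (p-prime : Prime p) {h : ℕ} (p≡2h+1 : p ≡ ℕ.suc (h ℕ.+ h)) (P W : ℤ) where

  open import Data.Nat.Base as ℕ using (zero; suc)
  import Data.Nat.Properties as ℕ
  open import Data.Nat.Primality using (prime⇒nonTrivial)
  open import Data.Nat.Base using (nonTrivial⇒n>1)
  import Data.Nat.Divisibility as ℕ
  open import Data.Integer.Base as ℤ using (+_; -[1+_]; 1ℤ)
  import Data.Integer.Properties as ℤ
  open import Data.Integer.Divisibility.Signed using (_∣_; ∣⇒∣ᵤ; divides)
  open import Data.Product using (Σ; _,_; proj₁; proj₂)
  open import Relation.Nullary using (¬_)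
  open import Relation.Binary.PropositionalEquality as ≡ using (_≡_)
  open import Data.Integer.Tactic.RingSolver using (solve-∀)
  open import Algebra.Bundles using (CommutativeRing)
  open Congruence using (_≡_mod_; mk≡mod; ∣-diff)
  open PrimeDivisibility p-prime
  open QuadraticAlgebra p P W public hiding (_≈_; isCommutativeRing)
  open QuadraticAlgebraProperties p P W public
  open CommutativeRing A public hiding (zero)
  open import Algebra.Properties.Ring ring using (-1*x≈-x)
  open import Algebra.Properties.CommutativeSemiring.Exp commutativeSemiring public
    using (_^_; ^-congˡ; ^-congʳ; ^-homo-*; ^-assocʳ; ^-distrib-*)
  open import Algebra.Definitions.RawMonoid +-rawMonoid public using (_×_)
  open import Relation.Binary.Reasoning.Setoid setoid public
  open CommutativeRingLemmas A public

  char-p : p × 1# ≈ 0#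
  char-p = trans (×1≈ι p) (ι-cong (Mod.∣⇒≡0 (divides 1ℤ (≡.sym (ℤ.*-identityˡ (+ p))))))

  frobenius : ∀ x y → (x + y) ^ p ≈ x ^ p + y ^ p
  frobenius = Frobenius.frobenius A p-prime char-p

  [-x]^p≈-[x^p] : ∀ x → (- x) ^ p ≈ - (x ^ p)
  [-x]^p≈-[x^p] x = begin
    (- x) ^ p          ≈⟨ ^-congˡ p (-1*x≈-x x) ⟨
    (- 1# * x) ^ p     ≈⟨ ^-distrib-* (- 1#) x p ⟩
    (- 1#) ^ p * x ^ p ≈⟨ *-congʳ [-1]^p ⟩
    - 1# * x ^ p       ≈⟨ -1*x≈-x _ ⟩
    - (x ^ p)          ∎
    where
    [-1]^p : (- 1#) ^ p ≈ - 1#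
    [-1]^p = begin
      (- 1#) ^ p                       ≈⟨ ^-congʳ (- 1#) p≡2h+1 ⟩
      - 1# * (- 1#) ^ (h ℕ.+ h)        ≈⟨ *-congˡ (^-homo-* (- 1#) h h) ⟩
      - 1# * ((- 1#) ^ h * (- 1#) ^ h) ≈⟨ *-congˡ (^-distrib-* (- 1#) (- 1#) h) ⟨
      - 1# * (- 1# * - 1#) ^ h         ≈⟨ *-congˡ (^-congˡ h (trans (-x*-y≈x*y 1# 1#) (*-identityˡ 1#))) ⟩
      - 1# * 1# ^ h                    ≈⟨ *-congˡ (1^n≈1 h) ⟩
      - 1# * 1#                        ≈⟨ *-identityʳ _ ⟩
      - 1#                             ∎

  frobenius-sub : ∀ x y → (x - y) ^ p ≈ x ^ p - y ^ p
  frobenius-sub x y = trans (frobenius x (- y)) (+-congˡ ([-x]^p≈-[x^p] y))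

  ι^p≈ι : ∀ c → ι c ^ p ≈ ι c
  ι^p≈ι (+ n)    = begin
    ι (+ n) ^ p  ≈⟨ ^-congˡ p (×1≈ι n) ⟨
    (n × 1#) ^ p ≈⟨ ×1^p n ⟩
    n × 1#       ≈⟨ ×1≈ι n ⟩
    ι (+ n)      ∎
    where
    ×1^p : ∀ n → (n × 1#) ^ p ≈ n × 1#
    ×1^p zero    = trans (^-congʳ 0# p≡2h+1) (zeroˡ _)
    ×1^p (suc n) = trans (frobenius 1# (n × 1#)) (+-cong (1^n≈1 p) (×1^p n))
  ι^p≈ι -[1+ n ] = begin
    ι -[1+ n ] ^ p      ≈⟨ ^-congˡ p (ι-homo-neg (+ suc n)) ⟨
    (- ι (+ suc n)) ^ p ≈⟨ [-x]^p≈-[x^p] _ ⟩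
    - (ι (+ suc n) ^ p) ≈⟨ -‿cong (ι^p≈ι (+ suc n)) ⟩
    - ι (+ suc n)       ≈⟨ ι-homo-neg (+ suc n) ⟩
    ι -[1+ n ]          ∎

  fermat : ∀ c → c ℤ.^ p ≡ c mod p
  fermat c = proj₁≈ (trans (sym (ι-homo-^ c p)) (ι^p≈ι c))

  c^2h≡1 : ∀ c → ¬ + p ∣ c → c ℤ.^ (h ℕ.+ h) ≡ 1ℤ mod p
  c^2h≡1 c p∤c = mk≡mod (∣m*n∧∤m⇒∣n c (c ℤ.^ (h ℕ.+ h) ℤ.- 1ℤ) p∣c[c^2h-1] p∤c)
    where
    factor : ∀ c x → c ℤ.* x ℤ.- c ≡ c ℤ.* (x ℤ.- 1ℤ)
    factor = solve-∀
    p∣c[c^2h-1] : + p ∣ c ℤ.* (c ℤ.^ (h ℕ.+ h) ℤ.- 1ℤ)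
    p∣c[c^2h-1] = ≡.subst (+ p ∣_) (factor c (c ℤ.^ (h ℕ.+ h)))
                    (∣-diff (≡.subst (λ k → c ℤ.^ k ≡ c mod p) p≡2h+1 (fermat c)))

  [c*c]^h≡1 : ∀ c → ¬ + p ∣ c → (c ℤ.* c) ℤ.^ h ≡ 1ℤ mod p
  [c*c]^h≡1 c p∤c = proj₁≈ (begin
    ι ((c ℤ.* c) ℤ.^ h) ≈⟨ ι-homo-^ (c ℤ.* c) h ⟨
    ι (c ℤ.* c) ^ h     ≈⟨ ^-congˡ h (ι-homo-* c c) ⟨
    (ι c * ι c) ^ h     ≈⟨ ^-distrib-* (ι c) (ι c) h ⟩
    ι c ^ h * ι c ^ h   ≈⟨ ^-homo-* (ι c) h h ⟨
    ι c ^ (h ℕ.+ h)     ≈⟨ ι-homo-^ c (h ℕ.+ h) ⟩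
    ι (c ℤ.^ (h ℕ.+ h)) ≈⟨ ι-cong (c^2h≡1 c p∤c) ⟩
    ι 1ℤ                ∎)

  x^p≈x⇒x^2h≈1 : ∀ {x y} → x * y ≈ 1# → x ^ p ≈ x → x ^ (h ℕ.+ h) ≈ 1#
  x^p≈x⇒x^2h≈1 {x} xy≈1 x^p≈x = *-cancelʳ-invertible xy≈1 (begin
    x ^ (h ℕ.+ h) * x ≈⟨ *-comm _ x ⟩
    x * x ^ (h ℕ.+ h) ≈⟨ ^-congʳ x p≡2h+1 ⟨
    x ^ p             ≈⟨ x^p≈x ⟩
    x                 ≈⟨ *-identityˡ x ⟨
    1# * x            ∎)

  p≥3 : 3 ℕ.≤ p
  p≥3 = ≡.subst (3 ℕ.≤_) (≡.sym p≡2h+1)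
          (OddNumbers.odd>1⇒≥3 h (≡.subst (1 ℕ.<_) p≡2h+1 (nonTrivial⇒n>1 p {{prime⇒nonTrivial p-prime}})))

  p∤2 : ¬ + p ∣ + 2
  p∤2 p∣2 = ℕ.<⇒≱ p≥3 (ℕ.∣⇒≤ (∣⇒∣ᵤ p∣2))

  conj-fixed⇒scalar : ∀ x → x ≈ conj x → IsScalar x
  conj-fixed⇒scalar (a , b) x≈conj[x] =
    Mod.∣⇒≡0 (∣m*n∧∤m⇒∣n (+ 2) b (≡.subst (+ p ∣_) (b+b b) (∣-diff (proj₂≈ x≈conj[x]))) p∤2)
    where
    b+b : ∀ b → b ℤ.- ℤ.- b ≡ + 2 ℤ.* b
    b+b = solve-∀

  ι*x-scalar⇒x-scalar : ∀ c x → ¬ + p ∣ c → IsScalar (ι c * x) → IsScalar x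
  ι*x-scalar⇒x-scalar c (a , b) p∤c s =
    Mod.∣⇒≡0 (∣m*n∧∤m⇒∣n c b (Mod.≡0⇒∣ (scalar-resp (ι-scale c a b) s)) p∤c)

  inverse-mod : ∀ c → ¬ + p ∣ c → Σ ℤ (λ c⁻ → c ℤ.* c⁻ ≡ 1ℤ mod p)
  inverse-mod c p∤c = c ℤ.^ (h ℕ.+ h ℕ.∸ 1) ,
    ≡.subst (λ k → c ℤ.^ k ≡ 1ℤ mod p) (≡.sym (ℕ.m+[n∸m]≡n 1≤2h)) (c^2h≡1 c p∤c)
    where
    1≤2h : 1 ℕ.≤ h ℕ.+ h
    1≤2h = ℕ.≤-trans (ℕ.n≤1+n 1) (ℕ.≤-pred (≡.subst (3 ℕ.≤_) p≡2h+1 p≥3))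

  ι-cancelˡ : ∀ c {x y} → ¬ + p ∣ c → ι c * x ≈ ι c * y → x ≈ y
  ι-cancelˡ c {x} {y} p∤c e = begin
    x                ≈⟨ *-identityˡ x ⟨
    1# * x           ≈⟨ *-congʳ c⁻c≈1 ⟨
    (ι c⁻ * ι c) * x ≈⟨ *-assoc _ _ _ ⟩
    ι c⁻ * (ι c * x) ≈⟨ *-congˡ e ⟩
    ι c⁻ * (ι c * y) ≈⟨ *-assoc _ _ _ ⟨
    (ι c⁻ * ι c) * y ≈⟨ *-congʳ c⁻c≈1 ⟩
    1# * y           ≈⟨ *-identityˡ y ⟩
    y                ∎
    where
    c⁻ = proj₁ (inverse-mod c p∤c)
    c⁻c≈1 : ι c⁻ * ι c ≈ 1#
    c⁻c≈1 = trans (*-comm _ _) (trans (ι-homo-* c c⁻) (ι-cong (proj₂ (inverse-mod c p∤c))))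

module LucasModPrime {p : ℕ} (p-prime : Prime p) {h : ℕ} (p≡2h+1 : p ≡ ℕ.suc (h ℕ.+ h))
                     (P Q : ℤ) (m : ℕ) .{{m≢0 : ℕ.NonZero m}} where

  open import Data.Nat.Base as ℕ using (zero; suc; _<_; s≤s; z≤n; nonTrivial⇒n>1)
  import Data.Nat.Tactic.RingSolver as ℕSolver
  open import Data.Nat.Primality using (euclidsLemma; prime⇒nonTrivial)
  import Data.Nat.Properties as ℕ
  open import Data.Nat.DivMod using (_%_; _/_; m≡m%n+[m/n]*n; m%n<n)
  import Data.Nat.Divisibility as ℕ
  open import Data.Integer.Base as ℤ using (+_; 0ℤ; 1ℤ)
  import Data.Integer.Properties as ℤ
  open import Data.Integer.Divisibility.Signed using (_∣_; _∣?_; ∣⇒∣ᵤ; ∣m⇒∣m*n; ∣n⇒∣m*n; ∣m∣n⇒∣m-n; ∣m∣n⇒∣m+n; ∣m⇒∣-m)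
  open import Data.Product using (_×_; _,_; proj₁; proj₂)
  open import Data.Sum as Sum using (_⊎_; inj₁; inj₂; [_,_]′)
  open import Data.Empty using (⊥-elim)
  open import Relation.Nullary using (¬_; Dec; yes; no)
  open import Relation.Nullary.Decidable using (map′; _×-dec_)
  open import Algebra.Definitions using (AlmostLeftCancellative)
  open import Function.Base using (id)
  open import Relation.Binary.PropositionalEquality as ≡ using (_≡_)
  open import Data.Integer.Tactic.RingSolver using (solve-∀)
  open Congruence using (_≡_mod_; ∣-diff)
  open PrimeDivisibility p-prime
  open Lucas using (lucas)
  open IntegerPowers using (^-distribʳ-*)
  open import Data.Nat.ListAction using (product)
  open import Data.Nat.Primality.Factorisation using (PrimeFactorisation; factorise)
  open import Data.List.Base using ([]; _∷_)
  open import Data.List.Relation.Unary.All using (All; []; _∷_)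
  open QuadraticAlgebraModPrime p-prime {h} p≡2h+1 P (Q ℤ.* Q) public
  open import Algebra.Properties.Ring ring using (-1*x≈-x; -‿involutive; -‿distribʳ-*; [y-z]x≈yx-zx)
  open import Algebra.Properties.CommutativeSemigroup *-commutativeSemigroup using (interchange)

  private
    W : ℤ
    W = Q ℤ.* Q
    U : ℕ → ℤ
    U = lucas P W

  module RankOfApparition (p∣U[m] : + p ∣ U m) (p∤U[j] : ∀ j → 0 < j → j < m → ¬ + p ∣ U j) (p∤Δ : ¬ + p ∣ Δ) where

    p∤Q : ¬ + p ∣ Q
    p∤Q p∣Q = p∤Δ (∣m∣n⇒∣m-n (∣m⇒∣m*n P p∣P) (∣n⇒∣m*n (+ 4) (∣m⇒∣m*n Q p∣Q)))
      where
      U[k+1]≡P^k : ∀ k → U (suc k) ≡ P ℤ.^ k mod p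
      U[k+1]≡P^k zero    = Mod.refl
      U[k+1]≡P^k (suc k) = Mod.trans (Mod.-cong (Mod.*-cong (Mod.refl {a = P}) (U[k+1]≡P^k k))
                                                 (Mod.∣⇒≡0 (∣m⇒∣m*n (U k) (∣m⇒∣m*n Q p∣Q))))
                                     (Mod.reflexive (ℤ.+-identityʳ _))
      p∣P : + p ∣ P
      p∣P = ∣^⇒∣ P (ℕ.pred m) (Mod.≡0⇒∣ (Mod.trans (Mod.sym (U[k+1]≡P^k (ℕ.pred m)))
              (Mod.∣⇒≡0 (≡.subst (λ k → + p ∣ U k) (≡.sym (ℕ.suc-pred m)) p∣U[m]))))

    p∤W : ¬ + p ∣ W
    p∤W = ∤*∤⇒∤ Q Q p∤Q p∤Q

    α^m≈ι : α ^ m ≈ ι (proj₁ (α ^ m))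
    α^m≈ι = scalar⇒≈ι (α ^ m) (∣lucas⇒scalar[α^k] m p∣U[m])

    β^m≈ι : β ^ m ≈ ι (proj₁ (α ^ m))
    β^m≈ι = begin
      β ^ m                    ≈⟨ ^-congˡ m conj-α ⟨
      conj α ^ m               ≈⟨ conj-homo-^ α m ⟨
      conj (α ^ m)             ≈⟨ conj-cong α^m≈ι ⟩
      conj (ι (proj₁ (α ^ m))) ≈⟨ conj-ι (proj₁ (α ^ m)) ⟩
      ι (proj₁ (α ^ m))        ∎

    α^m≈β^m : α ^ m ≈ β ^ m
    α^m≈β^m = trans α^m≈ι (sym β^m≈ι)

    p∤α^m : ¬ + p ∣ proj₁ (α ^ m)
    p∤α^m p∣c = ∤⇒∤^ W m p∤W (Mod.≡0⇒∣ (proj₁≈ (begin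
      ι (W ℤ.^ m)   ≈⟨ ι-homo-^ W m ⟨
      ι W ^ m       ≈⟨ ^-congˡ m α*β≈ιW ⟨
      (α * β) ^ m   ≈⟨ ^-distrib-* α β m ⟩
      α ^ m * β ^ m ≈⟨ *-cong α^m≈ι β^m≈ι ⟩
      ι c * ι c     ≈⟨ *-congʳ (ι-cong (Mod.∣⇒≡0 p∣c)) ⟩
      ι 0ℤ * ι c    ≈⟨ zeroˡ _ ⟩
      0#            ∎)))
      where c = proj₁ (α ^ m)

    -- α^m is a nonzero scalar, so α^n is a scalar exactly when α^(n mod m) is, and m is minimal.
    α^n-scalar⇒m∣n : ∀ n → IsScalar (α ^ n) → m ℕ.∣ n
    α^n-scalar⇒m∣n n α^n-scalar with n % m ℕ.≟ 0
    ... | yes r≡0 = ℕ.m%n≡0⇒n∣m n m r≡0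
    ... | no  r≢0 = ⊥-elim (p∤U[j] r (ℕ.n≢0⇒n>0 r≢0) (m%n<n n m)
                      (scalar[α^k]⇒∣lucas r (ι*x-scalar⇒x-scalar (c ℤ.^ k) (α ^ r) (∤⇒∤^ c k p∤α^m)
                         (scalar-resp α^n≈c^k*α^r α^n-scalar))))
      where
      c = proj₁ (α ^ m)
      r = n % m
      k = n / m
      α^n≈c^k*α^r : α ^ n ≈ ι (c ℤ.^ k) * α ^ r
      α^n≈c^k*α^r = begin
        α ^ n                 ≈⟨ ^-congʳ α (m≡m%n+[m/n]*n n m) ⟩
        α ^ (r ℕ.+ k ℕ.* m)   ≈⟨ ^-homo-* α r (k ℕ.* m) ⟩
        α ^ r * α ^ (k ℕ.* m) ≈⟨ *-congˡ (^-congʳ α (ℕ.*-comm k m)) ⟩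
        α ^ r * α ^ (m ℕ.* k) ≈⟨ *-congˡ (^-assocʳ α m k) ⟨
        α ^ r * (α ^ m) ^ k   ≈⟨ *-congˡ (^-congˡ k α^m≈ι) ⟩
        α ^ r * ι c ^ k       ≈⟨ *-congˡ (ι-homo-^ c k) ⟩
        α ^ r * ι (c ℤ.^ k)   ≈⟨ *-comm _ _ ⟩
        ι (c ℤ.^ k) * α ^ r   ∎

    α^k≈β^k⇒m∣k : ∀ k → α ^ k ≈ β ^ k → m ℕ.∣ k
    α^k≈β^k⇒m∣k k e = α^n-scalar⇒m∣n k (conj-fixed⇒scalar (α ^ k) (trans e (begin
      β ^ k        ≈⟨ ^-congˡ k conj-α ⟨
      conj α ^ k   ≈⟨ conj-homo-^ α k ⟨
      conj (α ^ k) ∎)))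

    α⁻ : Elt
    α⁻ = β * ι (proj₁ (inverse-mod W p∤W))

    α*α⁻≈1 : α * α⁻ ≈ 1#
    α*α⁻≈1 = begin
      α * (β * ι W⁻) ≈⟨ *-assoc α β (ι W⁻) ⟨
      (α * β) * ι W⁻ ≈⟨ *-congʳ α*β≈ιW ⟩
      ι W * ι W⁻     ≈⟨ ι-homo-* W W⁻ ⟩
      ι (W ℤ.* W⁻)   ≈⟨ ι-cong (proj₂ (inverse-mod W p∤W)) ⟩
      1#             ∎
      where W⁻ = proj₁ (inverse-mod W p∤W)

    α^k*α^k≈β^k*α^k⇒m∣k : ∀ k → α ^ k * α ^ k ≈ β ^ k * α ^ k → m ℕ.∣ k
    α^k*α^k≈β^k*α^k⇒m∣k k e = α^k≈β^k⇒m∣k k (*-cancelʳ-invertible (inverse-^ k α*α⁻≈1) e)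

    β^k*α^k≈ι[W]^k : ∀ k → β ^ k * α ^ k ≈ ι W ^ k
    β^k*α^k≈ι[W]^k k = trans (sym (^-distrib-* β α k)) (^-congˡ k (trans (*-comm β α) α*β≈ιW))

    ι[W]^h≈1 : ι W ^ h ≈ 1#
    ι[W]^h≈1 = begin
      ι W ^ h             ≈⟨ ^-congˡ h (ι-homo-* Q Q) ⟨
      (ι Q * ι Q) ^ h     ≈⟨ ^-distrib-* (ι Q) (ι Q) h ⟩
      ι Q ^ h * ι Q ^ h   ≈⟨ ^-homo-* (ι Q) h h ⟨
      ι Q ^ (h ℕ.+ h)     ≈⟨ ι-homo-^ Q (h ℕ.+ h) ⟩
      ι (Q ℤ.^ (h ℕ.+ h)) ≈⟨ ι-cong (c^2h≡1 Q p∤Q) ⟩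
      1#                  ∎

    -- Euler's criterion: the Frobenius fixes √Δ or negates it according to Δ^h ≡ ±1.
    2α^p≈P+√Δ*Δ^h : ι (+ 2) * α ^ p ≈ ι P + √Δ * ι (Δ ℤ.^ h)
    2α^p≈P+√Δ*Δ^h = begin
      ι (+ 2) * α ^ p              ≈⟨ *-congʳ (ι^p≈ι (+ 2)) ⟨
      ι (+ 2) ^ p * α ^ p          ≈⟨ ^-distrib-* (ι (+ 2)) α p ⟨
      (ι (+ 2) * α) ^ p            ≈⟨ ^-congˡ p 2α≈P+√Δ ⟩
      (ι P + √Δ) ^ p               ≈⟨ frobenius (ι P) √Δ ⟩
      ι P ^ p + √Δ ^ p             ≈⟨ +-cong (ι^p≈ι P) (^-congʳ √Δ p≡2h+1) ⟩
      ι P + √Δ * √Δ ^ (h ℕ.+ h)    ≈⟨ +-congˡ (*-congˡ (^-homo-* √Δ h h)) ⟩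
      ι P + √Δ * (√Δ ^ h * √Δ ^ h) ≈⟨ +-congˡ (*-congˡ (^-distrib-* √Δ √Δ h)) ⟨
      ι P + √Δ * (√Δ * √Δ) ^ h     ≈⟨ +-congˡ (*-congˡ (^-congˡ h √Δ*√Δ≈ιΔ)) ⟩
      ι P + √Δ * ι Δ ^ h           ≈⟨ +-congˡ (*-congˡ (ι-homo-^ Δ h)) ⟩
      ι P + √Δ * ι (Δ ℤ.^ h)       ∎

    Δ^h≡1⇒α^p≈α : Δ ℤ.^ h ≡ 1ℤ mod p → α ^ p ≈ α
    Δ^h≡1⇒α^p≈α Δ^h≡1 = ι-cancelˡ (+ 2) p∤2 (begin
      ι (+ 2) * α ^ p        ≈⟨ 2α^p≈P+√Δ*Δ^h ⟩
      ι P + √Δ * ι (Δ ℤ.^ h) ≈⟨ +-congˡ (*-congˡ (ι-cong Δ^h≡1)) ⟩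
      ι P + √Δ * 1#          ≈⟨ +-congˡ (*-identityʳ √Δ) ⟩
      ι P + √Δ               ≈⟨ 2α≈P+√Δ ⟨
      ι (+ 2) * α            ∎)

    Δ^h≡-1⇒α^p≈β : Δ ℤ.^ h ≡ ℤ.- 1ℤ mod p → α ^ p ≈ β
    Δ^h≡-1⇒α^p≈β Δ^h≡-1 = ι-cancelˡ (+ 2) p∤2 (begin
      ι (+ 2) * α ^ p        ≈⟨ 2α^p≈P+√Δ*Δ^h ⟩
      ι P + √Δ * ι (Δ ℤ.^ h) ≈⟨ +-congˡ (*-congˡ (trans (ι-cong Δ^h≡-1) (sym (ι-homo-neg 1ℤ)))) ⟩
      ι P + √Δ * - 1#        ≈⟨ +-congˡ (trans (*-comm √Δ (- 1#)) (-1*x≈-x √Δ)) ⟩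
      ι P - √Δ               ≈⟨ 2β≈P-√Δ ⟨
      ι (+ 2) * β            ∎)

    Δ^h≡1⇒m∣h : Δ ℤ.^ h ≡ 1ℤ mod p → m ℕ.∣ h
    Δ^h≡1⇒m∣h Δ^h≡1 = α^k*α^k≈β^k*α^k⇒m∣k h (begin
      α ^ h * α ^ h ≈⟨ ^-homo-* α h h ⟨
      α ^ (h ℕ.+ h) ≈⟨ x^p≈x⇒x^2h≈1 α*α⁻≈1 (Δ^h≡1⇒α^p≈α Δ^h≡1) ⟩
      1#            ≈⟨ ι[W]^h≈1 ⟨
      ι W ^ h       ≈⟨ β^k*α^k≈ι[W]^k h ⟨
      β ^ h * α ^ h ∎)

    Δ^h≡-1⇒m∣h+1 : Δ ℤ.^ h ≡ ℤ.- 1ℤ mod p → m ℕ.∣ suc h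
    Δ^h≡-1⇒m∣h+1 Δ^h≡-1 = α^k*α^k≈β^k*α^k⇒m∣k (suc h) (begin
      α ^ suc h * α ^ suc h ≈⟨ ^-homo-* α (suc h) (suc h) ⟨
      α ^ (suc h ℕ.+ suc h) ≈⟨ ^-congʳ α (≡.cong suc (≡.trans (ℕ.+-suc h h) (≡.sym p≡2h+1))) ⟩
      α * α ^ p             ≈⟨ *-congˡ (Δ^h≡-1⇒α^p≈β Δ^h≡-1) ⟩
      α * β                 ≈⟨ α*β≈ιW ⟩
      ι W                   ≈⟨ *-identityʳ (ι W) ⟨
      ι W * 1#              ≈⟨ *-congˡ ι[W]^h≈1 ⟨
      ι W ^ suc h           ≈⟨ β^k*α^k≈ι[W]^k (suc h) ⟨
      β ^ suc h * α ^ suc h ∎)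

    euler-dichotomy : m ℕ.∣ h ⊎ (m ℕ.∣ suc h × Δ ℤ.^ h ≡ ℤ.- 1ℤ mod p)
    euler-dichotomy = Sum.map Δ^h≡1⇒m∣h (λ Δ^h≡-1 → Δ^h≡-1⇒m∣h+1 Δ^h≡-1 , Δ^h≡-1) (x*x≡1⇒x≡±1 (Δ ℤ.^ h) Δ^h*Δ^h≡1)
      where
      Δ^h*Δ^h≡1 : Δ ℤ.^ h ℤ.* Δ ℤ.^ h ≡ 1ℤ mod p
      Δ^h*Δ^h≡1 = Mod.trans (Mod.reflexive (≡.sym (ℤ.^-distribˡ-+-* Δ h h))) (c^2h≡1 Δ p∤Δ)

    module NonResidue (Δ^h≡-1 : Δ ℤ.^ h ≡ ℤ.- 1ℤ mod p) where

      Δ≢square : ∀ c → ¬ Δ ≡ c ℤ.* c mod p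
      Δ≢square c Δ≡c² with + p ∣? c
      ... | yes p∣c = p∤Δ (Mod.≡0⇒∣ (Mod.trans Δ≡c² (Mod.*-cong (Mod.∣⇒≡0 p∣c) (Mod.refl {a = c}))))
      ... | no  p∤c = p∤2 (∣m⇒∣-m (∣-diff (Mod.trans (Mod.sym Δ^h≡-1)
                                          (Mod.trans (Mod.^-cong h Δ≡c²) ([c*c]^h≡1 c p∤c)))))

      Δb²≢square : ∀ t b → ¬ + p ∣ b → ¬ t ℤ.* t ≡ Δ ℤ.* (b ℤ.* b) mod p
      Δb²≢square t b p∤b t²≡Δb² = Δ≢square (t ℤ.* b⁻) (Mod.sym
        (Mod.trans (Mod.reflexive (rearrange₁ t b⁻))
        (Mod.trans (Mod.*-cong t²≡Δb² (Mod.refl {a = b⁻ ℤ.* b⁻}))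
        (Mod.trans (Mod.reflexive (rearrange₂ Δ b b⁻))
        (Mod.trans (Mod.*-cong (Mod.refl {a = Δ}) (Mod.*-cong bb⁻≡1 bb⁻≡1))
        (Mod.reflexive (ℤ.*-identityʳ Δ)))))))
        where
        b⁻ = proj₁ (inverse-mod b p∤b)
        bb⁻≡1 : b ℤ.* b⁻ ≡ 1ℤ mod p
        bb⁻≡1 = proj₂ (inverse-mod b p∤b)
        rearrange₁ : ∀ t c → (t ℤ.* c) ℤ.* (t ℤ.* c) ≡ (t ℤ.* t) ℤ.* (c ℤ.* c)
        rearrange₁ = solve-∀
        rearrange₂ : ∀ Δ b c → (Δ ℤ.* (b ℤ.* b)) ℤ.* (c ℤ.* c) ≡ Δ ℤ.* ((b ℤ.* c) ℤ.* (b ℤ.* c))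
        rearrange₂ = solve-∀

      [2a+Pb]²≡4N+Δb² : ∀ P Q a b → (+ 2 ℤ.* a ℤ.+ P ℤ.* b) ℤ.* (+ 2 ℤ.* a ℤ.+ P ℤ.* b)
                        ≡ + 4 ℤ.* (a ℤ.* a ℤ.+ P ℤ.* a ℤ.* b ℤ.+ (Q ℤ.* Q) ℤ.* b ℤ.* b)
                          ℤ.+ (P ℤ.* P ℤ.- + 4 ℤ.* (Q ℤ.* Q)) ℤ.* (b ℤ.* b)
      [2a+Pb]²≡4N+Δb² = solve-∀

      -- If p ∣ N(a + bα) then (2a + Pb)² ≡ Δ b², so p ∣ b as Δ is not a square, and then p ∣ a.
      p∤norm : ∀ x → x ≉ 0# → ¬ + p ∣ norm x
      p∤norm (a , b) x≉0 p∣N with + p ∣? b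
      ... | yes p∣b = x≉0 (Mod.∣⇒≡0 p∣a & Mod.∣⇒≡0 p∣b)
        where
        p∣2a+Pb : + p ∣ + 2 ℤ.* a ℤ.+ P ℤ.* b
        p∣2a+Pb = [ id , id ]′ (∣*⇒∣⊎∣ (+ 2 ℤ.* a ℤ.+ P ℤ.* b) (+ 2 ℤ.* a ℤ.+ P ℤ.* b)
                    (≡.subst (+ p ∣_) (≡.sym ([2a+Pb]²≡4N+Δb² P Q a b))
                       (∣m∣n⇒∣m+n (∣n⇒∣m*n (+ 4) p∣N) (∣n⇒∣m*n Δ (∣n⇒∣m*n b p∣b)))))
        p∣a : + p ∣ a
        p∣a = ∣m*n∧∤m⇒∣n (+ 2) a (≡.subst (+ p ∣_) (2a+Pb-Pb≡2a P a b) (∣m∣n⇒∣m-n p∣2a+Pb (∣n⇒∣m*n P p∣b))) p∤2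
          where
          2a+Pb-Pb≡2a : ∀ P a b → + 2 ℤ.* a ℤ.+ P ℤ.* b ℤ.- P ℤ.* b ≡ + 2 ℤ.* a
          2a+Pb-Pb≡2a = solve-∀
      ... | no  p∤b = Δb²≢square (+ 2 ℤ.* a ℤ.+ P ℤ.* b) b p∤b [2a+Pb]²≡Δb²
        where
        [2a+Pb]²≡Δb² : (+ 2 ℤ.* a ℤ.+ P ℤ.* b) ℤ.* (+ 2 ℤ.* a ℤ.+ P ℤ.* b) ≡ Δ ℤ.* (b ℤ.* b) mod p
        [2a+Pb]²≡Δb² = Mod.trans (Mod.reflexive ([2a+Pb]²≡4N+Δb² P Q a b))
                         (Mod.trans (Mod.+-cong (Mod.∣⇒≡0 (∣n⇒∣m*n (+ 4) p∣N)) Mod.refl)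
                         (Mod.reflexive (ℤ.+-identityˡ _)))

      ≈0? : ∀ x → Dec (x ≈ 0#)
      ≈0? (a , b) = map′ (λ (p∣a , p∣b) → Mod.∣⇒≡0 p∣a & Mod.∣⇒≡0 p∣b)
                         (λ (a≡0 & b≡0) → Mod.≡0⇒∣ a≡0 , Mod.≡0⇒∣ b≡0)
                         ((+ p ∣? a) ×-dec (+ p ∣? b))

      *-cancelˡ-nonZero : AlmostLeftCancellative _≈_ 0# _*_
      *-cancelˡ-nonZero x y z x≉0 xy≈xz = ι-cancelˡ (norm x) (p∤norm x x≉0) (begin
        ι (norm x) * y   ≈⟨ *-congʳ conj[x]*x≈ι[norm] ⟨
        (conj x * x) * y ≈⟨ *-assoc _ _ _ ⟩
        conj x * (x * y) ≈⟨ *-congˡ xy≈xz ⟩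
        conj x * (x * z) ≈⟨ *-assoc _ _ _ ⟨
        (conj x * x) * z ≈⟨ *-congʳ conj[x]*x≈ι[norm] ⟩
        ι (norm x) * z   ∎)
        where
        conj[x]*x≈ι[norm] : conj x * x ≈ ι (norm x)
        conj[x]*x≈ι[norm] = trans (*-comm (conj x) x) (x*conj[x]≈ι[norm] x)

      x*x≈1⇒x≈±1 : ∀ x → x * x ≈ 1# → x ≈ 1# ⊎ x ≈ - 1#
      x*x≈1⇒x≈±1 x x²≈1 with ≈0? (x - 1#)
      ... | yes x-1≈0 = inj₁ (x-y≈0⇒x≈y x-1≈0)
      ... | no  x-1≉0 = inj₂ (x-y≈0⇒x≈y (trans (+-congˡ (-‿involutive 1#))
                          (*-cancelˡ-nonZero (x - 1#) (x + 1#) 0# x-1≉0 (trans [x-1][x+1]≈0 (sym (zeroʳ _))))))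
        where
        [x-1][x+1]≈0 : (x - 1#) * (x + 1#) ≈ 0#
        [x-1][x+1]≈0 = begin
          (x - 1#) * (x + 1#)          ≈⟨ distribˡ (x - 1#) x 1# ⟩
          (x - 1#) * x + (x - 1#) * 1# ≈⟨ +-cong ([y-z]x≈yx-zx x x 1#) (*-identityʳ _) ⟩
          (x * x - 1# * x) + (x - 1#)  ≈⟨ +-congʳ (+-cong x²≈1 (-‿cong (*-identityˡ x))) ⟩
          (1# - x) + (x - 1#)          ≈⟨ +-assoc 1# (- x) (x - 1#) ⟩
          1# + (- x + (x - 1#))        ≈⟨ +-congˡ (+-assoc (- x) x (- 1#)) ⟨
          1# + ((- x + x) - 1#)        ≈⟨ +-congˡ (+-congʳ (-‿inverseˡ x)) ⟩
          1# + (0# - 1#)               ≈⟨ +-congˡ (+-identityˡ _) ⟩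
          1# - 1#                      ≈⟨ -‿inverseʳ 1# ⟩
          0#                           ∎

      p∤Q⁻ : ¬ + p ∣ proj₁ (inverse-mod Q p∤Q)
      p∤Q⁻ p∣Q⁻ = ∤1 (Mod.≡0⇒∣ (Mod.trans (Mod.sym (proj₂ (inverse-mod Q p∤Q))) (Mod.∣⇒≡0 (∣n⇒∣m*n Q p∣Q⁻))))

      -- θ = α / Q; its powers provide the roots of unity i and η needed for the Gauss product.
      θ : Elt
      θ = ι (proj₁ (inverse-mod Q p∤Q)) * α

      θ^k-scalar⇒m∣k : ∀ k → IsScalar (θ ^ k) → m ℕ.∣ k
      θ^k-scalar⇒m∣k k s = α^n-scalar⇒m∣n k (ι*x-scalar⇒x-scalar (Q⁻ ℤ.^ k) (α ^ k) (∤⇒∤^ Q⁻ k p∤Q⁻)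
                             (scalar-resp (trans (^-distrib-* (ι Q⁻) α k) (*-congʳ (ι-homo-^ Q⁻ k))) s))
        where Q⁻ = proj₁ (inverse-mod Q p∤Q)

      θ^2m≈1 : θ ^ (m ℕ.+ m) ≈ 1#
      θ^2m≈1 = begin
        θ ^ (m ℕ.+ m)                     ≈⟨ ^-homo-* θ m m ⟩
        θ ^ m * θ ^ m                     ≈⟨ *-cong (^-distrib-* u α m) (^-distrib-* u α m) ⟩
        (u ^ m * α ^ m) * (u ^ m * α ^ m) ≈⟨ interchange _ _ _ _ ⟩
        (u ^ m * u ^ m) * (α ^ m * α ^ m) ≈⟨ *-congˡ (*-congˡ α^m≈β^m) ⟩
        (u ^ m * u ^ m) * (α ^ m * β ^ m) ≈⟨ *-congˡ (^-distrib-* α β m) ⟨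
        (u ^ m * u ^ m) * (α * β) ^ m     ≈⟨ *-congˡ (^-congˡ m (trans α*β≈ιW (sym (ι-homo-* Q Q)))) ⟩
        (u ^ m * u ^ m) * (v * v) ^ m     ≈⟨ *-congˡ (^-distrib-* v v m) ⟩
        (u ^ m * u ^ m) * (v ^ m * v ^ m) ≈⟨ interchange _ _ _ _ ⟩
        (u ^ m * v ^ m) * (u ^ m * v ^ m) ≈⟨ *-cong (inverse-^ m u*v≈1) (inverse-^ m u*v≈1) ⟩
        1# * 1#                           ≈⟨ *-identityˡ 1# ⟩
        1#                                ∎
        where
        u = ι (proj₁ (inverse-mod Q p∤Q))
        v = ι Q
        u*v≈1 : u * v ≈ 1#
        u*v≈1 = trans (*-comm u v) (trans (ι-homo-* Q _) (ι-cong (proj₂ (inverse-mod Q p∤Q))))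

      m+m∣p+1 : m ℕ.+ m ℕ.∣ suc p
      m+m∣p+1 = double (Δ^h≡-1⇒m∣h+1 Δ^h≡-1)
        where
        double : m ℕ.∣ suc h → m ℕ.+ m ℕ.∣ suc p
        double (ℕ.divides k h+1≡k*m) = ℕ.divides k
          (≡.trans (≡.cong suc p≡2h+1) (≡.trans (≡.cong suc (≡.sym (ℕ.+-suc h h)))
          (≡.trans (≡.cong₂ ℕ._+_ h+1≡k*m h+1≡k*m) (≡.sym (ℕ.*-distribˡ-+ k m m)))))

      θ^[2m*k]≈1 : ∀ n → m ℕ.+ m ℕ.∣ n → θ ^ n ≈ 1#
      θ^[2m*k]≈1 n (ℕ.divides k n≡k*2m) =
        trans (^-congʳ θ (≡.trans n≡k*2m (ℕ.*-comm k (m ℕ.+ m)))) (x^n≈1⇒x^[n*k]≈1 (m ℕ.+ m) k θ^2m≈1)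

      module _ {m′ : ℕ} (m≡m′+m′ : m ≡ m′ ℕ.+ m′) where

        i : Elt
        i = θ ^ m′

        i*i≈θ^m : i * i ≈ θ ^ m
        i*i≈θ^m = trans (sym (^-homo-* θ m′ m′)) (^-congʳ θ (≡.sym m≡m′+m′))

        m∤m′ : ¬ m ℕ.∣ m′
        m∤m′ m∣m′ = ℕ.<⇒≱ m′<m (ℕ.∣⇒≤ {{ℕ.>-nonZero 0<m′}} m∣m′)
          where
          0<m′ : 0 < m′
          0<m′ = ℕ.n≢0⇒n>0 (λ m′≡0 → ℕ.≢-nonZero⁻¹ m (≡.trans m≡m′+m′ (≡.cong (λ k → k ℕ.+ k) m′≡0)))
          m′<m : m′ < m
          m′<m = ≡.subst (m′ <_) (≡.sym m≡m′+m′) (ℕ.m<m+n m′ 0<m′)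

        ±1⇒scalar : ∀ {x} → x ≈ 1# ⊎ x ≈ - 1# → IsScalar x
        ±1⇒scalar = [ ≈ι⇒scalar , (λ x≈-1 → ≈ι⇒scalar (trans x≈-1 (ι-homo-neg 1ℤ))) ]′

        i*i≈-1 : i * i ≈ - 1#
        i*i≈-1 = [ (λ θ^m≈1 → ⊥-elim (m∤m′ (θ^k-scalar⇒m∣k m′ (±1⇒scalar (x*x≈1⇒x≈±1 i (trans i*i≈θ^m θ^m≈1))))))
                 , trans i*i≈θ^m ]′ (x*x≈1⇒x≈±1 (θ ^ m) (trans (sym (^-homo-* θ m m)) θ^2m≈1))

        i^p≈-i : i ^ p ≈ - i
        i^p≈-i = *-cancelʳ-invertible i*-i≈1 (begin
          i ^ p * i          ≈⟨ *-comm _ i ⟩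
          i ^ suc p          ≈⟨ ^-assocʳ θ m′ (suc p) ⟩
          θ ^ (m′ ℕ.* suc p) ≈⟨ θ^[2m*k]≈1 _ (ℕ.∣n⇒∣m*n m′ m+m∣p+1) ⟩
          1#                 ≈⟨ i*-i≈1 ⟨
          i * - i            ≈⟨ *-comm i (- i) ⟩
          - i * i            ∎)
          where
          i*-i≈1 : i * - i ≈ 1#
          i*-i≈1 = trans (sym (-‿distribʳ-* i i)) (trans (-‿cong i*i≈-1) (-‿involutive 1#))

        module _ {q hq : ℕ} (q-prime : Prime q) (q≡2hq+1 : q ≡ suc (hq ℕ.+ hq)) (q∣m : q ℕ.∣ m) where

          open RootsOfUnity A using (IsPrimitiveRoot; gaussProduct; gaussProduct²≈q; gaussProduct^p)

          private
            t : ℕ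
            t = ℕ._∣_.quotient q∣m

            m≡t*q : m ≡ t ℕ.* q
            m≡t*q = ℕ._∣_.equality q∣m

          η : Elt
          η = θ ^ (t ℕ.+ t)

          q≥3 : 3 ℕ.≤ q
          q≥3 = ≡.subst (3 ℕ.≤_) (≡.sym q≡2hq+1)
                  (OddNumbers.odd>1⇒≥3 hq (≡.subst (1 ℕ.<_) q≡2hq+1 (nonTrivial⇒n>1 q {{prime⇒nonTrivial q-prime}})))

          η-primitive : IsPrimitiveRoot (suc (hq ℕ.+ hq)) η
          η-primitive = record
            { root    = trans (^-assocʳ θ (t ℕ.+ t) _) (θ^[2m*k]≈1 _ (ℕ.divides 1 [t+t]*q≡1*[m+m]))
            ; minimal = λ b 0<b b<q η^b≈1 → q∤2b b 0<b (≡.subst (b ℕ.<_) (≡.sym q≡2hq+1) b<q)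
                (ℕ.*-cancelˡ-∣ t {{t≢0}} (≡.subst₂ ℕ._∣_ m≡t*q ([t+t]*b≡t*[2*b] t b)
                  (θ^k-scalar⇒m∣k _ (≈ι⇒scalar {c = 1ℤ} (trans (sym (^-assocʳ θ (t ℕ.+ t) b)) η^b≈1)))))
            }
            where
            [t+t]*q≡1*[m+m] : (t ℕ.+ t) ℕ.* suc (hq ℕ.+ hq) ≡ 1 ℕ.* (m ℕ.+ m)
            [t+t]*q≡1*[m+m] = ≡.trans (≡.cong ((t ℕ.+ t) ℕ.*_) (≡.sym q≡2hq+1))
                              (≡.trans (ℕ.*-distribʳ-+ q t t) (≡.trans (≡.cong₂ ℕ._+_ (≡.sym m≡t*q) (≡.sym m≡t*q))
                              (≡.sym (ℕ.*-identityˡ (m ℕ.+ m)))))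
            [t+t]*b≡t*[2*b] : ∀ t b → (t ℕ.+ t) ℕ.* b ≡ t ℕ.* (2 ℕ.* b)
            [t+t]*b≡t*[2*b] = ℕSolver.solve-∀
            t≢0 : ℕ.NonZero t
            t≢0 = ℕ.≢-nonZero (λ t≡0 → ℕ.≢-nonZero⁻¹ m (≡.trans m≡t*q (≡.cong (ℕ._* q) t≡0)))
            q∤2b : ∀ b → 0 < b → b < q → ¬ q ℕ.∣ 2 ℕ.* b
            q∤2b b 0<b b<q q∣2b = [ (λ q∣2 → ℕ.<⇒≱ q≥3 (ℕ.∣⇒≤ q∣2))
                                  , (λ q∣b → ℕ.<⇒≱ b<q (ℕ.∣⇒≤ {{ℕ.>-nonZero 0<b}} q∣b)) ]′
                                  (euclidsLemma 2 b q-prime q∣2b)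

          η^p*η≈1 : η ^ p * η ≈ 1#
          η^p*η≈1 = begin
            η ^ p * η                 ≈⟨ *-comm _ η ⟩
            η ^ suc p                 ≈⟨ ^-assocʳ θ (t ℕ.+ t) (suc p) ⟩
            θ ^ ((t ℕ.+ t) ℕ.* suc p) ≈⟨ θ^[2m*k]≈1 _ (ℕ.∣n⇒∣m*n (t ℕ.+ t) m+m∣p+1) ⟩
            1#                        ∎

          p∤q : ¬ + p ∣ + q
          p∤q p∣q = ℕ.<⇒≱ h+1<p (ℕ.≤-trans (ℕ.∣⇒≤ {{ℕ.>-nonZero (ℕ.≤-trans (s≤s z≤n) q≥3)}} (∣⇒∣ᵤ p∣q))
                                           (ℕ.∣⇒≤ (ℕ.∣-trans q∣m (Δ^h≡-1⇒m∣h+1 Δ^h≡-1))))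
            where
            0<h : ∀ k → 3 ℕ.≤ suc (k ℕ.+ k) → 0 < k
            0<h zero    (s≤s ())
            0<h (suc k) _ = s≤s z≤n
            h+1<p : suc h < p
            h+1<p = ≡.subst (suc h <_) (≡.sym p≡2h+1) (s≤s (ℕ.m<m+n h (0<h h (≡.subst (3 ℕ.≤_) p≡2h+1 p≥3))))

          -- Z² = q and Z^p = Z, so q^h = Z^(p-1) = 1: q is a quadratic residue mod p.
          q^h≡1 : (+ q) ℤ.^ h ≡ 1ℤ mod p
          q^h≡1 = proj₁≈ (begin
            ι ((+ q) ℤ.^ h) ≈⟨ ι-homo-^ (+ q) h ⟨
            ι (+ q) ^ h     ≈⟨ ^-congˡ h Z*Z≈ιq ⟨
            (Z * Z) ^ h     ≈⟨ ^-distrib-* Z Z h ⟩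
            Z ^ h * Z ^ h   ≈⟨ ^-homo-* Z h h ⟨
            Z ^ (h ℕ.+ h)   ≈⟨ x^p≈x⇒x^2h≈1 Z*Z⁻≈1 Z^p≈Z ⟩
            ι 1ℤ            ∎)
            where
            Z : Elt
            Z = gaussProduct *-cancelˡ-nonZero {h = hq} η-primitive {i = i} i*i≈-1 hq
            Z^p≈Z : Z ^ p ≈ Z
            Z^p≈Z = gaussProduct^p *-cancelˡ-nonZero {h = hq} η-primitive {i = i} i*i≈-1
                      {p = p} frobenius-sub η^p*η≈1 i^p≈-i hq
            Z*Z≈ιq : Z * Z ≈ ι (+ q)
            Z*Z≈ιq = trans (gaussProduct²≈q *-cancelˡ-nonZero {h = hq} η-primitive {i = i} i*i≈-1)
                           (trans (×1≈ι _) (ι-cong (Mod.reflexive (≡.cong +_ (≡.sym q≡2hq+1)))))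
            q⁻ = proj₁ (inverse-mod (+ q) p∤q)
            Z*Z⁻≈1 : Z * (Z * ι q⁻) ≈ 1#
            Z*Z⁻≈1 = begin
              Z * (Z * ι q⁻) ≈⟨ *-assoc Z Z (ι q⁻) ⟨
              (Z * Z) * ι q⁻ ≈⟨ *-congʳ Z*Z≈ιq ⟩
              ι (+ q) * ι q⁻ ≈⟨ ι-homo-* (+ q) q⁻ ⟩
              ι (+ q ℤ.* q⁻) ≈⟨ ι-cong (proj₂ (inverse-mod (+ q) p∤q)) ⟩
              1#             ∎

        odd∣m⇒^h≡1 : ∀ n → .{{ℕ.NonZero n}} → ¬ 2 ℕ.∣ n → n ℕ.∣ m → (+ n) ℤ.^ h ≡ 1ℤ mod p
        odd∣m⇒^h≡1 n 2∤n n∣m = ≡.subst (λ k → (+ k) ℤ.^ h ≡ 1ℤ mod p) (≡.sym isFactorisation)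
          (∏^h≡1 factors factorsPrime (≡.subst (ℕ._∣ m) isFactorisation n∣m)
                 (≡.subst (λ k → ¬ 2 ℕ.∣ k) isFactorisation 2∤n))
          where
          open PrimeFactorisation (factorise n)
          ∏^h≡1 : ∀ qs → All Prime qs → product qs ℕ.∣ m → ¬ 2 ℕ.∣ product qs → (+ product qs) ℤ.^ h ≡ 1ℤ mod p
          ∏^h≡1 []       []                   _   _   = Mod.reflexive (ℤ.^-zeroˡ h)
          ∏^h≡1 (q ∷ qs) (q-prime ∷ qs-prime) ∏∣m 2∤∏ =
            Mod.trans (Mod.reflexive (≡.trans (≡.cong (ℤ._^ h) (ℤ.pos-* q (product qs)))
                                               (^-distribʳ-* (+ q) (+ product qs) h)))
                      (Mod.*-cong (q^h≡1 {hq = q / 2} q-prime (OddNumbers.odd⇒≡2k+1 q (OddNumbers.2∤n⇒n%2≡1 q 2∤q))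
                                           (ℕ.∣-trans (ℕ.∣m⇒∣m*n (product qs) ℕ.∣-refl) ∏∣m))
                                  (∏^h≡1 qs qs-prime (ℕ.∣-trans (ℕ.∣n⇒∣m*n q ℕ.∣-refl) ∏∣m)
                                         (λ 2∣∏qs → 2∤∏ (ℕ.∣n⇒∣m*n q 2∣∏qs))))
            where
            2∤q : ¬ 2 ℕ.∣ q
            2∤q 2∣q = 2∤∏ (ℕ.∣m⇒∣m*n (product qs) 2∣q)

        Δ≢odd*square : ∀ d D₁ → .{{ℕ.NonZero d}} → ¬ 2 ℕ.∣ d → d ℕ.∣ m → ¬ Δ ≡ + d ℤ.* (D₁ ℤ.* D₁)
        Δ≢odd*square d D₁ 2∤d d∣m Δ≡dD₁² = p∤2 (∣m⇒∣-m (∣-diff (Mod.trans (Mod.sym Δ^h≡-1) Δ^h≡1)))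
          where
          p∤D₁ : ¬ + p ∣ D₁
          p∤D₁ p∣D₁ = p∤Δ (≡.subst (+ p ∣_) (≡.sym Δ≡dD₁²) (∣n⇒∣m*n (+ d) (∣n⇒∣m*n D₁ p∣D₁)))
          Δ^h≡1 : Δ ℤ.^ h ≡ 1ℤ mod p
          Δ^h≡1 = Mod.trans (Mod.reflexive (≡.trans (≡.cong (ℤ._^ h) Δ≡dD₁²) (^-distribʳ-* (+ d) (D₁ ℤ.* D₁) h)))
                            (Mod.*-cong (odd∣m⇒^h≡1 d 2∤d d∣m) ([c*c]^h≡1 D₁ p∤D₁))

module LehmerAsLucas (R Q : ℤ) where

  open import Data.Bool.Base using (true; false; if_then_else_)
  open import Data.Nat.Base as ℕ using (ℕ; zero; suc; _<_; s≤s)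
  import Data.Nat.Properties as ℕ
  open import Data.Integer.Base using (+_; _+_; _-_; _*_; 0ℤ; 1ℤ)
  open import Data.Integer.Divisibility.Signed using (_∣_; ∣-refl; ∣-trans; ∣m⇒∣m*n; ∣n⇒∣m*n; ∣ᵤ⇒∣; ∣⇒∣ᵤ)
  open import Data.Product using (proj₁; proj₂)
  open import Relation.Nullary using (¬_)
  open import Data.Sum using ([_,_]′)
  open import Relation.Binary.PropositionalEquality using (_≡_; refl; sym; trans; cong; cong₂; subst)
  open import Data.Integer.Tactic.RingSolver using (solve-∀)
  open Lucas using (lucas)

  P W : ℤ
  P = R - + 2 * Q
  W = Q * Q

  isEven-suc-suc : ∀ k → isEven (suc (suc k)) ≡ isEven k
  isEven-suc-suc k with isEven k
  ... | true  = refl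
  ... | false = refl

  isEven-suc : ∀ k → isEven k ≡ true → isEven (suc k) ≡ false
  isEven-suc k e with isEven k
  isEven-suc k refl | true = refl

  isEven[k+k] : ∀ k → isEven (k ℕ.+ k) ≡ true
  isEven[k+k] zero    = refl
  isEven[k+k] (suc k) = trans (cong (λ n → isEven (suc n)) (ℕ.+-suc k k))
                              (trans (isEven-suc-suc (k ℕ.+ k)) (isEven[k+k] k))

  lehmer-even : ∀ j → isEven j ≡ true → lehmer R Q (suc (suc j)) ≡ lehmer R Q (suc j) - Q * lehmer R Q j
  lehmer-even j e = cong (λ b → (if b then lehmer R Q (suc j) else R * lehmer R Q (suc j)) - Q * lehmer R Q j) e

  lehmer-odd : ∀ j → isEven j ≡ false → lehmer R Q (suc (suc j)) ≡ R * lehmer R Q (suc j) - Q * lehmer R Q j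
  lehmer-odd j e = cong (λ b → (if b then lehmer R Q (suc j) else R * lehmer R Q (suc j)) - Q * lehmer R Q j) e

  lehmer-double-step : ∀ k → lehmer R Q (4 ℕ.+ (k ℕ.+ k))
                             ≡ P * lehmer R Q (2 ℕ.+ (k ℕ.+ k)) - W * lehmer R Q (k ℕ.+ k)
  lehmer-double-step k = trans u₄ (trans (cong (λ w → R * x - Q * w - Q * x) u₁) (combine R Q x y))
    where
    j = k ℕ.+ k
    x = lehmer R Q (2 ℕ.+ j)
    y = lehmer R Q j
    j-even : isEven j ≡ true
    j-even = isEven[k+k] k
    u₁ : lehmer R Q (suc j) ≡ x + Q * y
    u₁ = trans (sym (cancel (lehmer R Q (suc j)) (Q * y))) (cong (_+ Q * y) (sym (lehmer-even j j-even)))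
      where
      cancel : ∀ a b → a - b + b ≡ a
      cancel = solve-∀
    u₄ : lehmer R Q (4 ℕ.+ j) ≡ R * x - Q * lehmer R Q (suc j) - Q * x
    u₄ = trans (lehmer-even (2 ℕ.+ j) (trans (isEven-suc-suc j) j-even))
               (cong (_- Q * x) (lehmer-odd (suc j) (isEven-suc j j-even)))
    combine : ∀ R Q x y → R * x - Q * (x + Q * y) - Q * x ≡ (R - + 2 * Q) * x - Q * Q * y
    combine = solve-∀

  lehmer[k+k]≡lucas : ∀ k → lehmer R Q (k ℕ.+ k) ≡ lucas P W k
  lehmer[k+k]≡lucas zero          = refl
  lehmer[k+k]≡lucas (suc zero)    = one Q
    where
    one : ∀ Q → 1ℤ - Q * 0ℤ ≡ 1ℤ
    one = solve-∀
  lehmer[k+k]≡lucas (suc (suc k)) =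
    trans (cong (lehmer R Q) (trans (+-suc-suc (suc k)) (cong (λ n → suc (suc n)) (+-suc-suc k))))
    (trans (lehmer-double-step k)
           (cong₂ (λ a b → P * a - W * b)
                  (trans (cong (lehmer R Q) (sym (+-suc-suc k))) (lehmer[k+k]≡lucas (suc k)))
                  (lehmer[k+k]≡lucas k)))
    where
    +-suc-suc : ∀ n → suc n ℕ.+ suc n ≡ suc (suc (n ℕ.+ n))
    +-suc-suc n = cong suc (ℕ.+-suc n n)

  lehmerDisc≡Δ : P * P - + 4 * W ≡ lehmerDisc R Q
  lehmerDisc≡Δ = disc R Q
    where
    disc : ∀ R Q → (R - + 2 * Q) * (R - + 2 * Q) - + 4 * (Q * Q) ≡ R * (R - + 4 * Q)
    disc = solve-∀

  lehmer∣lehmerProdBelow : ∀ n j → 0 < j → j < n → lehmer R Q j ∣ lehmerProdBelow R Q n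
  lehmer∣lehmerProdBelow (suc (suc n)) j 0<j j<n+2 =
    [ (λ j<n+1 → ∣m⇒∣m*n (lehmer R Q (suc n)) (lehmer∣lehmerProdBelow (suc n) j 0<j j<n+1))
    , (λ { refl → ∣n⇒∣m*n (lehmerProdBelow R Q (suc n)) ∣-refl }) ]′
    (ℕ.m≤n⇒m<n∨m≡n (ℕ.≤-pred j<n+2))
  lehmer∣lehmerProdBelow (suc zero) (suc j) _ (s≤s ())

  module _ {p : ℕ} (m : ℕ) (p-primitive : PrimitiveDivisor R Q (m ℕ.+ m) p) where

    private
      p∤rest : ¬ + p ∣ lehmerDisc R Q * lehmerProdBelow R Q (m ℕ.+ m)
      p∤rest p∣rest = proj₂ (proj₂ p-primitive) (∣⇒∣ᵤ p∣rest)

    primitive⇒∣lucas : + p ∣ lucas P W m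
    primitive⇒∣lucas = subst (+ p ∣_) (lehmer[k+k]≡lucas m) (∣ᵤ⇒∣ (proj₁ (proj₂ p-primitive)))

    primitive⇒∤lucas : ∀ j → 0 < j → j < m → ¬ + p ∣ lucas P W j
    primitive⇒∤lucas j 0<j j<m p∣U[j] = p∤rest (∣n⇒∣m*n (lehmerDisc R Q)
      (∣-trans (subst (+ p ∣_) (sym (lehmer[k+k]≡lucas j)) p∣U[j])
               (lehmer∣lehmerProdBelow (m ℕ.+ m) (j ℕ.+ j) (ℕ.<-≤-trans 0<j (ℕ.m≤m+n j j)) (ℕ.+-mono-< j<m j<m))))

    primitive⇒∤Δ : ¬ + p ∣ P * P - + 4 * W
    primitive⇒∤Δ p∣Δ = p∤rest (∣m⇒∣m*n (lehmerProdBelow R Q (m ℕ.+ m)) (subst (+ p ∣_) lehmerDisc≡Δ p∣Δ))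

module LehmerPrimitiveDivisor where

  open import Data.Nat.Base as ℕ using (ℕ; suc; NonZero; _%_)
  import Data.Nat.Properties as ℕ
  open import Data.Nat.DivMod using (_/_)
  open import Data.Nat.Divisibility using (_∣_; divides; ∣-trans)
  open import Data.Integer.Base using (ℤ; +_; _*_)
  open import Data.Product using (_,_)
  open import Data.Sum using ([_,_]′)
  open import Data.Empty using (⊥-elim)
  open import Relation.Nullary using (¬_)
  open import Relation.Binary.PropositionalEquality using (_≡_; refl; sym; trans; cong; subst)
  open import Data.Nat.Tactic.RingSolver using (solve-∀)
  open OddNumbers

  primitive-divisor≡1-mod-4 : ∀ R Q d D₁ → .{{NonZero d}} → lehmerDisc R Q ≡ + d * (D₁ * D₁) → ¬ 2 ∣ d →
                              ∀ n p → 4 ℕ.* d ∣ n → .{{NonZero n}} → p % 2 ≡ 1 → PrimitiveDivisor R Q n p → p % 4 ≡ 1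
  primitive-divisor≡1-mod-4 R Q d D₁ Δ≡dD₁² 2∤d n p (divides c n≡c*4d) p%2≡1 p-primitive@(p-prime , _) =
    [ (λ m∣h → subst (λ k → k % 4 ≡ 1) (sym p≡2h+1) (2∣h⇒[2h+1]%4≡1 h (∣-trans 2∣m m∣h)))
    , (λ (_ , Δ^h≡-1) → ⊥-elim (NonResidue.Δ≢odd*square Δ^h≡-1 {m′} refl d D₁ 2∤d d∣m
                                   (trans (lehmerDisc≡Δ) Δ≡dD₁²)))
    ]′ euler-dichotomy
    where
    open LehmerAsLucas R Q using (P; lehmerDisc≡Δ; primitive⇒∣lucas; primitive⇒∤lucas; primitive⇒∤Δ)
    h : ℕ
    h = p / 2
    p≡2h+1 : p ≡ suc (h ℕ.+ h)
    p≡2h+1 = odd⇒≡2k+1 p p%2≡1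
    m′ m : ℕ
    m′ = c ℕ.* d
    m = m′ ℕ.+ m′
    n≡m+m : n ≡ m ℕ.+ m
    n≡m+m = trans n≡c*4d (split c d)
      where
      split : ∀ c d → c ℕ.* (4 ℕ.* d) ≡ (c ℕ.* d ℕ.+ c ℕ.* d) ℕ.+ (c ℕ.* d ℕ.+ c ℕ.* d)
      split = solve-∀
    instance
      m≢0 : NonZero m
      m≢0 = ℕ.≢-nonZero (λ m≡0 → ℕ.≢-nonZero⁻¹ n (trans n≡m+m (cong (λ k → k ℕ.+ k) m≡0)))
    2∣m : 2 ∣ m
    2∣m = divides m′ (double m′)
      where
      double : ∀ k → k ℕ.+ k ≡ k ℕ.* 2
      double = solve-∀
    d∣m : d ∣ m
    d∣m = divides (c ℕ.+ c) (sym (ℕ.*-distribʳ-+ d c c))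
    m-primitive : PrimitiveDivisor R Q (m ℕ.+ m) p
    m-primitive = subst (λ k → PrimitiveDivisor R Q k p) n≡m+m p-primitive
    open LucasModPrime.RankOfApparition p-prime {h} p≡2h+1 P Q m
           (primitive⇒∣lucas m m-primitive) (primitive⇒∤lucas m m-primitive) (primitive⇒∤Δ m m-primitive)
      using (euler-dichotomy; module NonResidue)

open import Data.Nat using (ℕ; suc; _%_)
open import Data.Integer using (ℤ; +_; _-_; _*_; _≤_; 0ℤ; 1ℤ)
open import Data.Integer.Divisibility using (_∣_)
open import Data.Integer.GCD using (gcd)
open import Data.Product using (_×_)
open import Relation.Binary.PropositionalEquality using (_≡_; _≢_)
open import Data.Integer using (+≤+; -[1+_])

lemma3p9 : (R Q : ℤ) → R ≢ 0ℤ → Q ≢ 0ℤ → gcd R Q ≡ 1ℤ →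
    lehmerDisc R Q ≢ 0ℤ → (∀ (n : ℕ) → lehmer R Q (suc n) ≢ 0ℤ) →
    (D₀ D₁ : ℤ) → lehmerDisc R Q ≡ D₀ * (D₁ * D₁) → SquareFree D₀ →
    + 5 ≤ D₀ → + 4 ∣ (D₀ - 1ℤ) →
    (ℓ : ℕ) → (+ 4 * D₀) ∣ (+ suc ℓ) →
    (p : ℕ) → p % 2 ≡ 1 → PrimitiveDivisor R Q (suc ℓ) p →
    p % 4 ≡ 1
lemma3p9 R Q _ _ _ _ _ (+ 0)     _  _ _ (+≤+ ()) _ _ _ _ _ _
lemma3p9 R Q _ _ _ _ _ -[1+ _ ]  _  _ _ ()       _ _ _ _ _ _
lemma3p9 R Q _ _ _ _ _ (+ suc k) D₁ Δ≡D₀D₁² _ _ 4∣D₀-1 ℓ 4D₀∣ℓ+1 p p%2≡1 p-primitive =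
  LehmerPrimitiveDivisor.primitive-divisor≡1-mod-4 R Q (suc k) D₁ Δ≡D₀D₁² (OddNumbers.4∣n⇒2∤1+n k 4∣D₀-1)
    (suc ℓ) p 4D₀∣ℓ+1 p%2≡1 p-primitive
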